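{- Let $E$ be a set of inequalities $t\sqsubseteq t'$ between finite partial $\Sigma$-terms $t,t'\in\mathrm{FT}_\Sigma X_\omega$, where $X_\omega$ is a countably infinite set of variables, and let $(\Delta X)_X$ be a quasi-regular family over $\Sigma$. Let $\mathcal V_\omega$ be the class of $\omega$-continuous ordered $\Sigma$-algebras satisfying $E$, $\mathcal V_r$ the class of $\Delta$-algebras satisfying $E$, and $\mathcal V$ the class of ordered $\Sigma$-algebras satisfying $E$. For a set $X$, let $F_\omega(X)$ be the free algebra in $\mathcal V_\omega$ on generators $X$, let $F(X)$ be the free algebra in $\mathcal V$ on $X$, and let $$R(X)=\{t^{F_\omega(X)}\mid t\in\Delta X\}\subseteq F_\omega(X),$$ with order and operations inherited from $F_\omega(X)$, where $t^{F_\omega(X)}$ is the image of $t$ under the unique $\omega$-continuous morphism $\mathrm{CT}_\Sigma X\to F_\omega(X)$ that is the identity on the generators $X$. Then $R(X)$ is the free $\Delta$-algebra in $\mathcal V_r$ on generators $X$: $R(X)\in\mathcal V_r$, and for every $A\in\mathcal V_r$ and every map $h:X\to A$ there is a unique morphism of $\Delta$-algebras $R(X)\to A$ extending $h$. Moreover, $R(X)$ is isomorphic to the completion of $F(X)$ by $\Delta$-ideals.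
   Context: $\Sigma$ is a ranked alphabet. An ordered $\Sigma$-algebra is a $\Sigma$-algebra partially ordered by $\le$ with least element $\bot$ and monotone operations; it is $\omega$-continuous if every countable directed subset has a supremum and each operation preserves such suprema: $f(\bigvee C_1,\dots,\bigvee C_n)=\bigvee\{f(c_1,\dots,c_n)\mid c_i\in C_i\}$. An ordered algebra $A$ satisfies $t\sqsubseteq t'$ if $t^A\le t'^A$ pointwise as functions $A^{X_\omega}\to A$. $\mathrm{CT}_\Sigma X$ is the set of partial $\Sigma$-coterms over $X$ (finite or infinite trees with nodes labelled by symbols of $\Sigma$ of arity equal to their number of children, leaves possibly labelled by elements of $X$ or the empty term $\bot$), ordered by $s\le t$ iff $t$ arises from $s$ by replacing occurrences of $\bot$ by coterms; it is the free $\omega$-continuous algebra on $X$; $\mathrm{FT}_\Sigma X$ is the subset of finite partial terms. A quasi-regular family assigns to each set $X$ an ordered subalgebra $\Delta X$ of $\mathrm{CT}_\Sigma X$ containing $X$ such that every $\omega$-continuous morphism $h:\mathrm{CT}_\Sigma X\to\mathrm{CT}_\Sigma Y$ with $h(X)\subseteq\Delta Y$ satisfies $h(\Delta X)\subseteq\Delta Y$. For a map $g:A\to B$, $\Delta g$ replaces each leaf label $a$ by $g(a)$. $t_1\ll t_2$ means $t_1$ is finite and obtained from $t_2$ by replacing some subterms by $\bot$. For an ordered $\Sigma$-algebra $A$ with evaluation $\alpha:\mathrm{FT}_\Sigma A\to A$ of finite partial terms, a $\Delta$-set is a set $\{\alpha(s)\mid s\ll t\}$ with $t\in\Delta A$,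 and a $\Delta$-ideal is the downward closure $\downarrow B=\{c\mid \exists b\in B,\ c\le b\}$ of a $\Delta$-set $B$. $A$ is $\Delta$-regular if all $\Delta$-sets have suprema and the operations preserve them. A $\Delta$-algebra is a $\Delta$-regular algebra with structure map $\alpha:\Delta A\to A$, $\alpha(t)=\bigvee\{\alpha(s)\mid s\ll t\}$; a morphism of $\Delta$-algebras is a strict monotone map $h$ with $h(\alpha(t))=\beta((\Delta h)(t))$ for all $t\in\Delta A$. The completion of an ordered algebra $P$ by $\Delta$-ideals is the set of $\Delta$-ideals of $P$ ordered by inclusion, with operations $f(C_1,\dots,C_n)=\downarrow\{f^P(c_1,\dots,c_n)\mid c_i\in C_i\}$ and with $x\in X$ identified with $\downarrow\{x\}$; the isomorphism is as $\Delta$-algebras, mapping generators to generators. -}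

module Defs where

open import Data.Nat using (ℕ; zero; suc)
open import Data.Fin using (Fin)
open import Data.Product using (Σ; ∃; ∃-syntax; _×_; _,_; proj₁; proj₂)
open import Relation.Binary.PropositionalEquality using (_≡_; refl; trans)

record Sig : Set₁ where
  field
    Op : Set
    ar : Op → ℕ

_⇔_ : Set → Set → Set
A ⇔ B = (A → B) × (B → A)

module _ (S : Sig) where
  open Sig S

  data FT (X : Set) : Set where
    ⊥t   : FT X
    var  : X → FT X
    node : (f : Op) → (Fin (ar f) → FT X) → FT X

  data _≐_ {X : Set} : FT X → FT X → Set where
    ⊥≐    : ⊥t ≐ ⊥t
    var≐  : ∀ {x y} → x ≡ y → var x ≐ var y
    node≐ : ∀ {f ss ts} → (∀ i → ss i ≐ ts i) → node f ss ≐ node f ts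

  ≐-refl : {X : Set} (s : FT X) → s ≐ s
  ≐-refl ⊥t = ⊥≐
  ≐-refl (var x) = var≐ refl
  ≐-refl (node f ss) = node≐ (λ i → ≐-refl (ss i))

  ≐-trans : {X : Set} {s t u : FT X} → s ≐ t → t ≐ u → s ≐ u
  ≐-trans ⊥≐ ⊥≐ = ⊥≐
  ≐-trans (var≐ p) (var≐ q) = var≐ (trans p q)
  ≐-trans (node≐ p) (node≐ q) = node≐ (λ i → ≐-trans (p i) (q i))

  trunc : {X : Set} → ℕ → FT X → FT X
  trunc zero s = ⊥t
  trunc (suc n) ⊥t = ⊥t
  trunc (suc n) (var x) = var x
  trunc (suc n) (node f ss) = node f (λ i → trunc n (ss i))

  -- Partial coterms CT_Σ X (finite or infinite trees), presented as the
  -- coherent sequences of their depth-n truncations (CT_Σ X is the limit of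
  -- the truncation chain).
  record CT (X : Set) : Set where
    field
      approx : ℕ → FT X
      coh    : ∀ n → trunc n (approx (suc n)) ≐ approx n
  open CT public

  _≈c_ : {X : Set} → CT X → CT X → Set
  s ≈c t = ∀ n → approx s n ≐ approx t n

  ⊥CT : {X : Set} → CT X
  ⊥CT = record { approx = λ _ → ⊥t ; coh = c }
    where
      c : ∀ n → trunc n ⊥t ≐ ⊥t
      c zero = ⊥≐
      c (suc n) = ⊥≐

  leaf : {X : Set} → X → CT X
  leaf {X} x = record { approx = a ; coh = c }
    where
      a : ℕ → FT X
      a zero = ⊥t
      a (suc n) = var x
      c : ∀ n → trunc n (a (suc n)) ≐ a n
      c zero = ⊥≐
      c (suc n) = var≐ refl

  nodeCT : {X : Set} → (f : Op) → (Fin (ar f) → CT X) → CT X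
  nodeCT {X} f ts = record { approx = a ; coh = c }
    where
      a : ℕ → FT X
      a zero = ⊥t
      a (suc n) = node f (λ i → approx (ts i) n)
      c : ∀ n → trunc n (a (suc n)) ≐ a n
      c zero = ⊥≐
      c (suc n) = node≐ (λ i → coh (ts i) n)

  subT : {X Y : Set} → ℕ → (X → CT Y) → FT X → FT Y
  subT zero σ s = ⊥t
  subT (suc n) σ ⊥t = ⊥t
  subT (suc n) σ (var x) = approx (σ x) (suc n)
  subT (suc n) σ (node f ss) = node f (λ i → subT n σ (ss i))

  subT-resp : {X Y : Set} (n : ℕ) (σ : X → CT Y) {s t : FT X} → s ≐ t → subT n σ s ≐ subT n σ t
  subT-resp zero σ p = ⊥≐
  subT-resp (suc n) σ ⊥≐ = ⊥≐
  subT-resp (suc n) σ (var≐ refl) = ≐-refl _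
  subT-resp (suc n) σ (node≐ p) = node≐ (λ i → subT-resp n σ (p i))

  trunc-subT : {X Y : Set} (n : ℕ) (σ : X → CT Y) (s : FT X) →
               trunc n (subT (suc n) σ s) ≐ subT n σ (trunc n s)
  trunc-subT zero σ s = ⊥≐
  trunc-subT (suc n) σ ⊥t = ⊥≐
  trunc-subT (suc n) σ (var x) = coh (σ x) (suc n)
  trunc-subT (suc n) σ (node f ss) = node≐ (λ i → trunc-subT n σ (ss i))

  -- Substitution of coterms for the leaf labels: these are exactly the
  -- ω-continuous morphisms CT_Σ X → CT_Σ Y (CT_Σ X is free ω-continuous on X).
  subst : {X Y : Set} → (X → CT Y) → CT X → CT Y
  subst σ t = record
    { approx = λ n → subT n σ (approx t n)
    ; coh = λ n → ≐-trans (trunc-subT n σ (approx t (suc n))) (subT-resp n σ (coh t n)) }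

  mapCT : {A B : Set} → (A → B) → CT A → CT B
  mapCT g = subst (λ a → leaf (g a))

  data _≪F_ {X : Set} : FT X → FT X → Set where
    ⊥≪    : ∀ {u} → ⊥t ≪F u
    var≪  : ∀ {x} → var x ≪F var x
    node≪ : ∀ {f ss us} → (∀ i → ss i ≪F us i) → node f ss ≪F node f us

  -- s ≪ t : s finite, obtained from the coterm t by replacing some subterms by ⊥
  -- (equivalently: s is such a cut of some finite truncation of t).
  _≪_ : {X : Set} → FT X → CT X → Set
  s ≪ t = ∃[ n ] (s ≪F approx t n)

  record QuasiRegular : Set₁ where
    field
      Δ      : (X : Set) → CT X → Set
      Δ-resp : ∀ {X} {s t : CT X} → s ≈c t → Δ X s → Δ X t
      Δ-⊥    : ∀ {X} → Δ X ⊥CT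
      Δ-node : ∀ {X} f (ts : Fin (ar f) → CT X) → (∀ i → Δ X (ts i)) → Δ X (nodeCT f ts)
      Δ-var  : ∀ {X} (x : X) → Δ X (leaf x)
      Δ-subst : ∀ {X Y} (σ : X → CT Y) → (∀ x → Δ Y (σ x)) →
                ∀ t → Δ X t → Δ Y (subst σ t)

  -- Ordered Σ-algebras (partial order up to ≈ := ≤ ∩ ≥).
  record IsOAlg (C : Set) (_≤_ : C → C → Set) : Set where
    field
      ≤-refl  : ∀ a → a ≤ a
      ≤-trans : ∀ {a b c} → a ≤ b → b ≤ c → a ≤ c
      ⊥       : C
      ⊥-min   : ∀ a → ⊥ ≤ a
      op      : (f : Op) → (Fin (ar f) → C) → C
      op-mono : ∀ f (as bs : Fin (ar f) → C) → (∀ i → as i ≤ bs i) → op f as ≤ op f bs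

  record OAlg : Set₁ where
    constructor mkOAlg
    field
      Carrier : Set
      _≤_     : Carrier → Carrier → Set
      isOAlg  : IsOAlg Carrier _≤_
    open IsOAlg isOAlg public

    _≈_ : Carrier → Carrier → Set
    a ≈ b = (a ≤ b) × (b ≤ a)

    IsSup : (Carrier → Set) → Carrier → Set
    IsSup P u = (∀ a → P a → a ≤ u) × (∀ v → (∀ a → P a → a ≤ v) → u ≤ v)

    eval : {V : Set} → (V → Carrier) → FT V → Carrier
    eval env ⊥t = ⊥
    eval env (var x) = env x
    eval env (node f ss) = op f (λ i → eval env (ss i))

    α₀ : FT Carrier → Carrier
    α₀ = eval (λ a → a)

    Approx : {V : Set} → (V → Carrier) → CT V → Carrier → Set
    Approx env t a = ∃[ s ] (s ≪ t × a ≡ eval env s)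

    DSet : CT Carrier → Carrier → Set
    DSet t = Approx (λ a → a) t

    ↓ : (Carrier → Set) → Carrier → Set
    ↓ B c = ∃[ b ] (B b × c ≤ b)

    Im : (ℕ → Carrier) → Carrier → Set
    Im c a = ∃[ k ] (a ≡ c k)

    Directed : (ℕ → Carrier) → Set
    Directed c = ∀ i j → ∃[ k ] (c i ≤ c k × c j ≤ c k)

  Car : OAlg → Set
  Car = OAlg.Carrier

  Sat : (FT ℕ → FT ℕ → Set) → OAlg → Set
  Sat E A = ∀ l r → E l r → ∀ (env : ℕ → Car A) → A ._≤_ (eval A env l) (eval A env r)
    where open OAlg

  -- ω-continuity (countable directed subsets = images of directed ℕ-families).
  record IsOmegaCont (A : OAlg) : Set where
    open OAlg A
    field
      sup-exists : ∀ (c : ℕ → Carrier) → Directed c → ∃[ u ] IsSup (Im c) u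
      op-sup : ∀ f (cs : Fin (ar f) → ℕ → Carrier) (us : Fin (ar f) → Carrier) →
               (∀ i → Directed (cs i)) → (∀ i → IsSup (Im (cs i)) (us i)) →
               IsSup (λ a → Σ (Fin (ar f) → ℕ) λ ks → a ≡ op f (λ i → cs i (ks i))) (op f us)

  record IsMor (A B : OAlg) (h : Car A → Car B) : Set where
    private module A = OAlg A
    private module B = OAlg B
    field
      strict : h A.⊥ B.≈ B.⊥
      mono   : ∀ {a b} → a A.≤ b → h a B.≤ h b
      hom    : ∀ f (as : Fin (ar f) → A.Carrier) → h (A.op f as) B.≈ B.op f (λ i → h (as i))

  record IsOmegaMor (A B : OAlg) (h : Car A → Car B) : Set where
    private module A = OAlg A
    private module B = OAlg B
    field
      isMor : IsMor A B h
      cont  : ∀ (c : ℕ → A.Carrier) (u : A.Carrier) → A.Directed c → A.IsSup (A.Im c) u →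
              B.IsSup (B.Im (λ k → h (c k))) (h u)

  record FreeOmega (E : FT ℕ → FT ℕ → Set) (X : Set) (F : OAlg) (η : X → Car F) : Set₁ where
    private module F = OAlg F
    field
      F-cont : IsOmegaCont F
      F-sat  : Sat E F
      univ   : ∀ (B : OAlg) → IsOmegaCont B → Sat E B → (h : X → Car B) →
               ∃[ g ] (IsOmegaMor F B g × (∀ x → OAlg._≈_ B (g (η x)) (h x)) ×
                 (∀ g' → IsOmegaMor F B g' → (∀ x → OAlg._≈_ B (g' (η x)) (h x)) →
                   ∀ a → OAlg._≈_ B (g' a) (g a)))

  record FreeV (E : FT ℕ → FT ℕ → Set) (X : Set) (F : OAlg) (η : X → Car F) : Set₁ where
    field
      F-sat  : Sat E F
      univ   : ∀ (B : OAlg) → Sat E B → (h : X → Car B) →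
               ∃[ g ] (IsMor F B g × (∀ x → OAlg._≈_ B (g (η x)) (h x)) ×
                 (∀ g' → IsMor F B g' → (∀ x → OAlg._≈_ B (g' (η x)) (h x)) →
                   ∀ a → OAlg._≈_ B (g' a) (g a)))

  module _ (QR : QuasiRegular) where
    open QuasiRegular QR

    record IsDeltaAlg (A : OAlg) : Set where
      open OAlg A
      field
        α      : (t : CT Carrier) → Δ Carrier t → Carrier
        α-sup  : ∀ t (p : Δ Carrier t) → IsSup (DSet t) (α t p)
        op-sup : ∀ f (ts : Fin (ar f) → CT Carrier) (us : Fin (ar f) → Carrier) →
                 (∀ i → Δ Carrier (ts i)) → (∀ i → IsSup (DSet (ts i)) (us i)) →
                 IsSup (λ a → Σ (Fin (ar f) → Carrier) λ bs → (∀ i → DSet (ts i) (bs i)) × a ≡ op f bs) (op f us)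

    record IsDeltaMor (A : OAlg) (dA : IsDeltaAlg A) (B : OAlg) (dB : IsDeltaAlg B)
                      (h : Car A → Car B) : Set where
      private module A = OAlg A
      private module B = OAlg B
      field
        strict : h A.⊥ B.≈ B.⊥
        mono   : ∀ {a b} → a A.≤ b → h a B.≤ h b
        pres-α : ∀ t (p : Δ A.Carrier t) (q : Δ B.Carrier (mapCT h t)) →
                 h (IsDeltaAlg.α dA t p) B.≈ IsDeltaAlg.α dB (mapCT h t) q

    module _ (E : FT ℕ → FT ℕ → Set) (X : Set)
             (Fω : OAlg) (ηω : X → Car Fω) (F : OAlg) (η : X → Car F) where
      private module Fω = OAlg Fω
      private module F = OAlg F

      -- R(X) = { t^{Fω} | t ∈ ΔX }, where t^{Fω} = ⋁ { s^{Fω} | s ≪ t }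
      RCarrier : Set
      RCarrier = Σ Fω.Carrier λ a → ∃[ t ] (Δ X t × Fω.IsSup (Fω.Approx ηω t) a)

      _≤R_ : RCarrier → RCarrier → Set
      r ≤R r' = proj₁ r Fω.≤ proj₁ r'

      RAlg : IsOAlg RCarrier _≤R_ → OAlg
      RAlg s = mkOAlg RCarrier _≤R_ s

      -- Δ-ideals of F(X), each represented by a t ∈ Δ(F(X)) generating it
      CCarrier : Set
      CCarrier = Σ (CT F.Carrier) (Δ F.Carrier)

      Ideal : CCarrier → F.Carrier → Set
      Ideal C = F.↓ (F.DSet (proj₁ C))

      _≤C_ : CCarrier → CCarrier → Set
      C ≤C D = ∀ c → Ideal C c → Ideal D c

      CAlg : IsOAlg CCarrier _≤C_ → OAlg
      CAlg s = mkOAlg CCarrier _≤C_ s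

      record Conclusion : Set₁ where
        field
          Rstr : IsOAlg RCarrier _≤R_
          R-⊥  : proj₁ (IsOAlg.⊥ Rstr) ≡ Fω.⊥
          R-op : ∀ f (rs : Fin (Sig.ar S f) → RCarrier) →
                 proj₁ (IsOAlg.op Rstr f rs) ≡ Fω.op f (λ i → proj₁ (rs i))
          ηR   : X → RCarrier
          ηR-def : ∀ x → proj₁ (ηR x) ≡ ηω x
          RΔ   : IsDeltaAlg (RAlg Rstr)
          R-sat : Sat E (RAlg Rstr)
          R-free : ∀ (A : OAlg) (dA : IsDeltaAlg A) → Sat E A → (h : X → Car A) →
                   ∃[ g ] (IsDeltaMor (RAlg Rstr) RΔ A dA g ×
                     (∀ x → OAlg._≈_ A (g (ηR x)) (h x)) ×
                     (∀ g' → IsDeltaMor (RAlg Rstr) RΔ A dA g' →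
                       (∀ x → OAlg._≈_ A (g' (ηR x)) (h x)) →
                       ∀ r → OAlg._≈_ A (g' r) (g r)))
          Cstr : IsOAlg CCarrier _≤C_
          C-op : ∀ f (Cs : Fin (Sig.ar S f) → CCarrier) (c : F.Carrier) →
                 Ideal (IsOAlg.op Cstr f Cs) c ⇔
                 F.↓ (λ b → Σ (Fin (Sig.ar S f) → F.Carrier) λ bs → (∀ i → Ideal (Cs i) (bs i)) × b ≡ F.op f bs) c
          ηC   : X → CCarrier
          ηC-def : ∀ x c → Ideal (ηC x) c ⇔ (c F.≤ η x)
          CΔ   : IsDeltaAlg (CAlg Cstr)
          φ    : RCarrier → CCarrier
          ψ    : CCarrier → RCarrier
          φ-mor : IsDeltaMor (RAlg Rstr) RΔ (CAlg Cstr) CΔ φ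
          ψ-mor : IsDeltaMor (CAlg Cstr) CΔ (RAlg Rstr) RΔ ψ
          ψφ   : ∀ r → OAlg._≈_ (RAlg Rstr) (ψ (φ r)) r
          φψ   : ∀ C → OAlg._≈_ (CAlg Cstr) (φ (ψ C)) C
          φ-gen : ∀ x → OAlg._≈_ (CAlg Cstr) (φ (ηR x)) (ηC x)

-- Each t ∈ ΔX denotes t^Fω = ⋁{s^Fω | s ≪ t}; the extension of h : X → A to R(X) sends it to
-- t^A = α(Δh t). This is well defined and monotone because A embeds into its algebra of ω-chains,
-- which lies in V_ω: the ω-continuous extension of h to Fω(X) sends t^Fω to the chain of finite
-- approximations of t in A, so t^Fω ≤ t'^Fω forces t^A ≤ t'^A. Preservation of α is the substitution
-- lemma (σ t)^A = t^(x ↦ (σ x)^A), which holds as soon as the operations of A preserve the suprema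
-- involved. The Δ-ideal completion of F(X) is matched with R(X) by t^Fω ↦ ↓{α(s) | s ≪ Δη t}; the
-- inverse replaces every element of F(X) by a finite term denoting it, and such terms are chosen
-- by a morphism from F(X) into the algebra of finite terms ordered by their values.
module Submission where

open import Defs
open import Data.Nat using (ℕ; zero; suc; z≤n; s≤s; _⊔_; _≤′_; ≤′-refl; ≤′-step)
  renaming (_≤_ to _≤ℕ_)
open import Data.Nat.Properties using (≤⇒≤′; m≤m⊔n; m≤n⊔m; n≤1+n; m≤n⇒m<n∨m≡n)
  renaming (≤-refl to ≤ℕ-refl; ≤-trans to ≤ℕ-trans)
open import Data.Fin using (Fin; zero; suc)
open import Data.Sum using (inj₁; inj₂)
open import Data.Unit using (⊤; tt)
open import Data.Product using (Σ; ∃-syntax; _×_; _,_; proj₁; proj₂)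
open import Relation.Binary.PropositionalEquality using (_≡_; refl; sym)

module _ {A : Set} (_∼_ : A → A → Set) (∼-refl : ∀ a → a ∼ a)
         (∼-trans : ∀ {a b c} → a ∼ b → b ∼ c → a ∼ c) where

  steps⇒mono : (c : ℕ → A) → (∀ n → c n ∼ c (suc n)) → ∀ {m n} → m ≤ℕ n → c m ∼ c n
  steps⇒mono c step {m} m≤n = go (≤⇒≤′ m≤n)
    where
    go : ∀ {n} → m ≤′ n → c m ∼ c n
    go ≤′-refl = ∼-refl (c m)
    go (≤′-step m≤′n) = ∼-trans (go m≤′n) (step _)

maxᶠ : ∀ {k} → (Fin k → ℕ) → ℕ
maxᶠ {zero} g = 0
maxᶠ {suc k} g = g zero ⊔ maxᶠ (λ i → g (suc i))

≤-maxᶠ : ∀ {k} (g : Fin k → ℕ) i → g i ≤ℕ maxᶠ g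
≤-maxᶠ g zero = m≤m⊔n (g zero) _
≤-maxᶠ g (suc i) = ≤ℕ-trans (≤-maxᶠ (λ j → g (suc j)) i) (m≤n⊔m (g zero) _)

module Coterms (S : Sig) where
  open Sig S

  infix 4 _≐ₜ_ _≪ᶠ_ _≪ᶜ_ _≈ᶜ_ _⊑ᶜ_

  _≐ₜ_ : {X : Set} → FT S X → FT S X → Set
  _≐ₜ_ = _≐_ S

  _≪ᶠ_ : {X : Set} → FT S X → FT S X → Set
  _≪ᶠ_ = _≪F_ S

  _≪ᶜ_ : {X : Set} → FT S X → CT S X → Set
  _≪ᶜ_ = _≪_ S

  -- Equality and order of coterms are wrapped in records so that Agda can infer the coterms.
  record _≈ᶜ_ {X : Set} (T₁ T₂ : CT S X) : Set where
    constructor mk≈ᶜ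
    field un≈ᶜ : _≈c_ S T₁ T₂
  open _≈ᶜ_ public

  record _⊑ᶜ_ {X : Set} (T₁ T₂ : CT S X) : Set where
    constructor mk⊑ᶜ
    field un⊑ᶜ : ∀ n → ∃[ m ] (approx T₁ n ≪ᶠ approx T₂ m)
  open _⊑ᶜ_ public

  ≐-sym : ∀ {X} {s t : FT S X} → s ≐ₜ t → t ≐ₜ s
  ≐-sym ⊥≐ = ⊥≐
  ≐-sym (var≐ p) = var≐ (sym p)
  ≐-sym (node≐ p) = node≐ (λ i → ≐-sym (p i))

  ≪-refl : ∀ {X} (s : FT S X) → s ≪ᶠ s
  ≪-refl ⊥t = ⊥≪
  ≪-refl (var x) = var≪
  ≪-refl (node f ss) = node≪ (λ i → ≪-refl (ss i))

  ≪-trans : ∀ {X} {s t u : FT S X} → s ≪ᶠ t → t ≪ᶠ u → s ≪ᶠ u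
  ≪-trans ⊥≪ q = ⊥≪
  ≪-trans var≪ var≪ = var≪
  ≪-trans (node≪ p) (node≪ q) = node≪ (λ i → ≪-trans (p i) (q i))

  ≐⇒≪ : ∀ {X} {s t : FT S X} → s ≐ₜ t → s ≪ᶠ t
  ≐⇒≪ ⊥≐ = ⊥≪
  ≐⇒≪ (var≐ refl) = var≪
  ≐⇒≪ (node≐ p) = node≪ (λ i → ≐⇒≪ (p i))

  ≪-antisym : ∀ {X} {s t : FT S X} → s ≪ᶠ t → t ≪ᶠ s → s ≐ₜ t
  ≪-antisym ⊥≪ ⊥≪ = ⊥≐
  ≪-antisym var≪ var≪ = var≐ refl
  ≪-antisym (node≪ p) (node≪ q) = node≐ (λ i → ≪-antisym (p i) (q i))

  trunc-≪ : ∀ {X} n (s : FT S X) → trunc S n s ≪ᶠ s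
  trunc-≪ zero s = ⊥≪
  trunc-≪ (suc n) ⊥t = ⊥≪
  trunc-≪ (suc n) (var x) = var≪
  trunc-≪ (suc n) (node f ss) = node≪ (λ i → trunc-≪ n (ss i))

  ≪-trunc⇒≪-trunc-self : ∀ {X} n {s u : FT S X} → s ≪ᶠ trunc S n u → s ≪ᶠ trunc S n s
  ≪-trunc⇒≪-trunc-self zero ⊥≪ = ⊥≪
  ≪-trunc⇒≪-trunc-self (suc n) {u = ⊥t} ⊥≪ = ⊥≪
  ≪-trunc⇒≪-trunc-self (suc n) {u = var x} ⊥≪ = ⊥≪
  ≪-trunc⇒≪-trunc-self (suc n) {u = var x} var≪ = var≪
  ≪-trunc⇒≪-trunc-self (suc n) {u = node f us} ⊥≪ = ⊥≪
  ≪-trunc⇒≪-trunc-self (suc n) {u = node f us} (node≪ p) =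
    node≪ (λ i → ≪-trunc⇒≪-trunc-self n (p i))

  trunc-trunc : ∀ {X} n (s : FT S X) → trunc S n (trunc S (suc n) s) ≐ₜ trunc S n s
  trunc-trunc zero s = ⊥≐
  trunc-trunc (suc n) ⊥t = ⊥≐
  trunc-trunc (suc n) (var x) = var≐ refl
  trunc-trunc (suc n) (node f ss) = node≐ (λ i → trunc-trunc n (ss i))

  depth : ∀ {X} → FT S X → ℕ
  depth ⊥t = 0
  depth (var x) = 1
  depth (node f ss) = suc (maxᶠ (λ i → depth (ss i)))

  depth≤⇒≪-trunc : ∀ {X} n (s : FT S X) → depth s ≤ℕ n → s ≪ᶠ trunc S n s
  depth≤⇒≪-trunc zero ⊥t _ = ⊥≪
  depth≤⇒≪-trunc (suc n) ⊥t _ = ⊥≪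
  depth≤⇒≪-trunc (suc n) (var x) _ = var≪
  depth≤⇒≪-trunc (suc n) (node f ss) (s≤s d≤n) =
    node≪ (λ i → depth≤⇒≪-trunc n (ss i) (≤ℕ-trans (≤-maxᶠ (λ j → depth (ss j)) i) d≤n))

  approx-≪-suc : ∀ {X} (t : CT S X) n → approx t n ≪ᶠ approx t (suc n)
  approx-≪-suc t n = ≪-trans (≐⇒≪ (≐-sym (coh t n))) (trunc-≪ n (approx t (suc n)))

  approx-mono : ∀ {X} (t : CT S X) {m n} → m ≤ℕ n → approx t m ≪ᶠ approx t n
  approx-mono t = steps⇒mono _≪ᶠ_ ≪-refl ≪-trans (approx t) (approx-≪-suc t)

  approx-≪-trunc : ∀ {X} (t : CT S X) n → approx t n ≪ᶠ trunc S n (approx t n)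
  approx-≪-trunc t n = ≪-trunc⇒≪-trunc-self n (≐⇒≪ (≐-sym (coh t n)))

  fin : ∀ {X} → FT S X → CT S X
  fin s = record { approx = λ n → trunc S n s ; coh = λ n → trunc-trunc n s }

  ≪-fin : ∀ {X} (s : FT S X) → s ≪ᶜ fin s
  ≪-fin s = depth s , depth≤⇒≪-trunc (depth s) s ≤ℕ-refl

  ≈⇒⊑ : ∀ {X} {T₁ T₂ : CT S X} → T₁ ≈ᶜ T₂ → T₁ ⊑ᶜ T₂
  ≈⇒⊑ (mk≈ᶜ p) = mk⊑ᶜ (λ n → n , ≐⇒≪ (p n))

  ≪ᶜ-⊑-trans : ∀ {X} {s : FT S X} {T₁ T₂} → s ≪ᶜ T₁ → T₁ ⊑ᶜ T₂ → s ≪ᶜ T₂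
  ≪ᶜ-⊑-trans (n , s≪) (mk⊑ᶜ q) with q n
  ... | m , ≪u = m , ≪-trans s≪ ≪u

  ≪ᶜ⇒fin-⊑ : ∀ {X} {s : FT S X} {T : CT S X} → s ≪ᶜ T → fin s ⊑ᶜ T
  ≪ᶜ⇒fin-⊑ {s = s} (n , s≪) = mk⊑ᶜ (λ m → n , ≪-trans (trunc-≪ m s) s≪)

  ≪ᶜ-common-level : ∀ {X k} {ss : Fin k → FT S X} {ts : Fin k → CT S X} →
                    (∀ i → ss i ≪ᶜ ts i) → ∃[ N ] (∀ i → ss i ≪ᶠ approx (ts i) N)
  ≪ᶜ-common-level {ts = ts} ss≪ =
    maxᶠ level , λ i → ≪-trans (proj₂ (ss≪ i)) (approx-mono (ts i) (≤-maxᶠ level i))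
    where
    level = λ i → proj₁ (ss≪ i)

  ≈ᶜ-sym : ∀ {X} {T₁ T₂ : CT S X} → T₁ ≈ᶜ T₂ → T₂ ≈ᶜ T₁
  ≈ᶜ-sym (mk≈ᶜ p) = mk≈ᶜ (λ n → ≐-sym (p n))

  ≈ᶜ-trans : ∀ {X} {T₁ T₂ T₃ : CT S X} → T₁ ≈ᶜ T₂ → T₂ ≈ᶜ T₃ → T₁ ≈ᶜ T₃
  ≈ᶜ-trans (mk≈ᶜ p) (mk≈ᶜ q) = mk≈ᶜ (λ n → ≐-trans S (p n) (q n))

  ≈ᶜ-suc : ∀ {X} {T₁ T₂ : CT S X} →
           (∀ n → approx T₁ (suc n) ≐ₜ approx T₂ (suc n)) → T₁ ≈ᶜ T₂
  ≈ᶜ-suc {T₁ = T₁} {T₂} ≐suc = mk≈ᶜ λ where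
    zero → ≐-trans S (≐-sym (coh T₁ 0)) (coh T₂ 0)
    (suc n) → ≐suc n

  nodeCT-resp : ∀ {X} f {ts ts' : Fin (ar f) → CT S X} → (∀ i → ts i ≈ᶜ ts' i) →
                nodeCT S f ts ≈ᶜ nodeCT S f ts'
  nodeCT-resp f ts≈ = ≈ᶜ-suc (λ n → node≐ (λ i → un≈ᶜ (ts≈ i) n))

  fin-⊥ : ∀ {X} → fin {X} ⊥t ≈ᶜ ⊥CT S
  fin-⊥ = ≈ᶜ-suc (λ n → ⊥≐)

  fin-var : ∀ {X} (x : X) → fin (var x) ≈ᶜ leaf S x
  fin-var x = ≈ᶜ-suc (λ n → ≐-refl S _)

  fin-node : ∀ {X} f (ss : Fin (ar f) → FT S X) → fin (node f ss) ≈ᶜ nodeCT S f (λ i → fin (ss i))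
  fin-node f ss = ≈ᶜ-suc (λ n → ≐-refl S _)

  module _ {X Y : Set} (σ : X → CT S Y) where

    subT-mono-≪ : ∀ n {s s' : FT S X} → s ≪ᶠ s' → subT S n σ s ≪ᶠ subT S n σ s'
    subT-mono-≪ zero _ = ⊥≪
    subT-mono-≪ (suc n) ⊥≪ = ⊥≪
    subT-mono-≪ (suc n) var≪ = ≪-refl _
    subT-mono-≪ (suc n) (node≪ p) = node≪ (λ i → subT-mono-≪ n (p i))

    subT-mono-depth : ∀ {m n} (s : FT S X) → m ≤ℕ n → subT S m σ s ≪ᶠ subT S n σ s
    subT-mono-depth s z≤n = ⊥≪
    subT-mono-depth ⊥t (s≤s _) = ⊥≪
    subT-mono-depth (var x) (s≤s m≤n) = approx-mono (σ x) (s≤s m≤n)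
    subT-mono-depth (node f ss) (s≤s m≤n) = node≪ (λ i → subT-mono-depth (ss i) m≤n)

    subst-mono : {T₁ T₂ : CT S X} → T₁ ⊑ᶜ T₂ → subst S σ T₁ ⊑ᶜ subst S σ T₂
    subst-mono {T₁} {T₂} (mk⊑ᶜ p) = mk⊑ᶜ go
      where
      go : ∀ n → ∃[ k ] (_ ≪ᶠ _)
      go n with p n
      ... | m , ≪T₂ = n ⊔ m , ≪-trans (subT-mono-≪ n ≪T₂)
                                (≪-trans (subT-mono-depth (approx T₂ m) (m≤m⊔n n m))
                                         (subT-mono-≪ (n ⊔ m) (approx-mono T₂ (m≤n⊔m n m))))

    subst-resp : {T₁ T₂ : CT S X} → T₁ ≈ᶜ T₂ → subst S σ T₁ ≈ᶜ subst S σ T₂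
    subst-resp (mk≈ᶜ p) = mk≈ᶜ (λ n → subT-resp S n σ (p n))

    subst-⊥ : subst S σ (⊥CT S) ≈ᶜ ⊥CT S
    subst-⊥ = ≈ᶜ-suc (λ n → ⊥≐)

    subst-leaf : ∀ x → subst S σ (leaf S x) ≈ᶜ σ x
    subst-leaf x = ≈ᶜ-suc (λ n → ≐-refl S _)

    subst-node : ∀ f (ts : Fin (ar f) → CT S X) →
                 subst S σ (nodeCT S f ts) ≈ᶜ nodeCT S f (λ i → subst S σ (ts i))
    subst-node f ts = ≈ᶜ-suc (λ n → ≐-refl S _)

    subst-fin-⊥ : subst S σ (fin ⊥t) ≈ᶜ ⊥CT S
    subst-fin-⊥ = ≈ᶜ-trans (subst-resp fin-⊥) subst-⊥

    subst-fin-var : ∀ x → subst S σ (fin (var x)) ≈ᶜ σ x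
    subst-fin-var x = ≈ᶜ-trans (subst-resp (fin-var x)) (subst-leaf x)

    subst-fin-node : ∀ f (ss : Fin (ar f) → FT S X) →
                     subst S σ (fin (node f ss)) ≈ᶜ nodeCT S f (λ i → subst S σ (fin (ss i)))
    subst-fin-node f ss = ≈ᶜ-trans (subst-resp (fin-node f ss)) (subst-node f (λ i → fin (ss i)))

  subT-resp-σ : ∀ {X Y} {σ σ' : X → CT S Y} → (∀ x → σ x ≈ᶜ σ' x) →
                ∀ n s → subT S n σ s ≐ₜ subT S n σ' s
  subT-resp-σ σ≈ zero s = ⊥≐
  subT-resp-σ σ≈ (suc n) ⊥t = ⊥≐
  subT-resp-σ σ≈ (suc n) (var x) = un≈ᶜ (σ≈ x) (suc n)
  subT-resp-σ σ≈ (suc n) (node f ss) = node≐ (λ i → subT-resp-σ σ≈ n (ss i))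

  subst-resp-σ : ∀ {X Y} {σ σ' : X → CT S Y} → (∀ x → σ x ≈ᶜ σ' x) →
                 ∀ T → subst S σ T ≈ᶜ subst S σ' T
  subst-resp-σ σ≈ T = mk≈ᶜ (λ n → subT-resp-σ σ≈ n (approx T n))

  subT-subT : ∀ {X Y Z} (σ : X → CT S Y) (τ : Y → CT S Z) n s →
              subT S n τ (subT S n σ s) ≐ₜ subT S n (λ x → subst S τ (σ x)) s
  subT-subT σ τ zero s = ⊥≐
  subT-subT σ τ (suc n) ⊥t = ⊥≐
  subT-subT σ τ (suc n) (var x) = ≐-refl S _
  subT-subT σ τ (suc n) (node f ss) = node≐ (λ i → subT-subT σ τ n (ss i))

  subst-subst : ∀ {X Y Z} (σ : X → CT S Y) (τ : Y → CT S Z) T →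
                subst S τ (subst S σ T) ≈ᶜ subst S (λ x → subst S τ (σ x)) T
  subst-subst σ τ T = mk≈ᶜ (λ n → subT-subT σ τ n (approx T n))

  subT-leaf : ∀ {X} n (s : FT S X) → subT S n (leaf S) s ≐ₜ trunc S n s
  subT-leaf zero s = ⊥≐
  subT-leaf (suc n) ⊥t = ⊥≐
  subT-leaf (suc n) (var x) = var≐ refl
  subT-leaf (suc n) (node f ss) = node≐ (λ i → subT-leaf n (ss i))

  subst-leaf-id : ∀ {X} (T : CT S X) → subst S (leaf S) T ≈ᶜ T
  subst-leaf-id T =
    mk≈ᶜ (λ n → ≐-trans S (subT-leaf n (approx T n))
                          (≪-antisym (trunc-≪ n _) (approx-≪-trunc T n)))

module QuasiRegularProperties (S : Sig) (QR : QuasiRegular S) where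
  open Coterms S
  open QuasiRegular QR

  Δ-fin : ∀ {X} (s : FT S X) → Δ X (fin s)
  Δ-fin ⊥t = Δ-resp (un≈ᶜ (≈ᶜ-sym fin-⊥)) Δ-⊥
  Δ-fin (var x) = Δ-resp (un≈ᶜ (≈ᶜ-sym (fin-var x))) (Δ-var x)
  Δ-fin (node f ss) = Δ-resp (un≈ᶜ (≈ᶜ-sym (fin-node f ss))) (Δ-node f _ (λ i → Δ-fin (ss i)))

  Δ-mapCT : ∀ {X Y} (g : X → Y) (t : CT S X) → Δ X t → Δ Y (mapCT S g t)
  Δ-mapCT g = Δ-subst (λ x → leaf S (g x)) (λ x → Δ-var (g x))

module OrderedAlgebra (S : Sig) (A : OAlg S) where
  open Sig S
  open OAlg A

  Subset : Set₁
  Subset = Carrier → Set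

  ≡⇒≤ : ∀ {a b} → a ≡ b → a ≤ b
  ≡⇒≤ refl = ≤-refl _

  ≈-refl : ∀ a → a ≈ a
  ≈-refl a = ≤-refl a , ≤-refl a

  ≈-sym : ∀ {a b} → a ≈ b → b ≈ a
  ≈-sym (a≤b , b≤a) = b≤a , a≤b

  ≈-trans : ∀ {a b c} → a ≈ b → b ≈ c → a ≈ c
  ≈-trans (a≤b , b≤a) (b≤c , c≤b) = ≤-trans a≤b b≤c , ≤-trans c≤b b≤a

  op-resp-≈ : ∀ f {as bs : Fin (ar f) → Carrier} → (∀ i → as i ≈ bs i) → op f as ≈ op f bs
  op-resp-≈ f as≈bs =
    op-mono f _ _ (λ i → proj₁ (as≈bs i)) , op-mono f _ _ (λ i → proj₂ (as≈bs i))

  eval-mono-env : ∀ {V} {env env' : V → Carrier} → (∀ v → env v ≤ env' v) →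
                  ∀ s → eval env s ≤ eval env' s
  eval-mono-env env≤ ⊥t = ⊥-min _
  eval-mono-env env≤ (var x) = env≤ x
  eval-mono-env env≤ (node f ss) = op-mono f _ _ (λ i → eval-mono-env env≤ (ss i))

  eval-resp-env : ∀ {V} {env env' : V → Carrier} → (∀ v → env v ≈ env' v) →
                  ∀ s → eval env s ≈ eval env' s
  eval-resp-env env≈ s =
    eval-mono-env (λ v → proj₁ (env≈ v)) s , eval-mono-env (λ v → proj₂ (env≈ v)) s

  module _ (B : OAlg S) (k : Car S B → Carrier) (k-⊥ : k (OAlg.⊥ B) ≈ ⊥)
           (k-op : ∀ f bs → k (OAlg.op B f bs) ≈ op f (λ i → k (bs i))) where

    eval-hom : ∀ {V} (env : V → Car S B) s → k (OAlg.eval B env s) ≈ eval (λ v → k (env v)) s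
    eval-hom env ⊥t = k-⊥
    eval-hom env (var x) = ≈-refl _
    eval-hom env (node f ss) = ≈-trans (k-op f _) (op-resp-≈ f (λ i → eval-hom env (ss i)))

    sat-reflect : ∀ E → (∀ {b b'} → k b ≤ k b' → OAlg._≤_ B b b') → Sat S E A → Sat S E B
    sat-reflect E k-reflects satA l r l⊑r env =
      k-reflects (≤-trans (proj₁ (eval-hom env l))
                          (≤-trans (satA l r l⊑r _) (proj₂ (eval-hom env r))))

  OpImage : (f : Op) → (Fin (ar f) → Subset) → Subset
  OpImage f Ps a = Σ (Fin (ar f) → Carrier) λ bs → (∀ i → Ps i (bs i)) × a ≡ op f bs

  infix 4 _⊆_
  _⊆_ : Subset → Subset → Set
  P ⊆ Q = ∀ a → P a → Q a

  UpperBound : Subset → Carrier → Set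
  UpperBound P v = ∀ a → P a → a ≤ v

  infix 4 _≼_
  _≼_ : Subset → Subset → Set
  P ≼ Q = ∀ a → P a → ∃[ b ] (Q b × a ≤ b)

  ≼-refl : (P : Subset) → P ≼ P
  ≼-refl P a a∈P = a , a∈P , ≤-refl a

  ⊆⇒≼ : {P Q : Subset} → P ⊆ Q → P ≼ Q
  ⊆⇒≼ P⊆Q a a∈P = a , P⊆Q a a∈P , ≤-refl a

  ≼-trans : {P Q R : Subset} → P ≼ Q → Q ≼ R → P ≼ R
  ≼-trans P≼Q Q≼R a a∈P with P≼Q a a∈P
  ... | b , b∈Q , a≤b with Q≼R b b∈Q
  ... | c , c∈R , b≤c = c , c∈R , ≤-trans a≤b b≤c

  ≼-upperBound : {P Q : Subset} {v : Carrier} → P ≼ Q → UpperBound Q v → UpperBound P v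
  ≼-upperBound P≼Q Q≤v a a∈P with P≼Q a a∈P
  ... | b , b∈Q , a≤b = ≤-trans a≤b (Q≤v b b∈Q)

  ≼⇒sup-≤ : {P Q : Subset} {u v : Carrier} → P ≼ Q → IsSup P u → IsSup Q v → u ≤ v
  ≼⇒sup-≤ P≼Q (_ , u-least) (Q≤v , _) = u-least _ (≼-upperBound P≼Q Q≤v)

  sup-unique : {P : Subset} {u v : Carrier} → IsSup P u → IsSup P v → u ≈ v
  sup-unique {P} u-sup v-sup = ≼⇒sup-≤ (≼-refl P) u-sup v-sup , ≼⇒sup-≤ (≼-refl P) v-sup u-sup

  IsSup-cofinal : {P Q : Subset} {u : Carrier} → P ≼ Q → Q ≼ P → IsSup P u → IsSup Q u
  IsSup-cofinal P≼Q Q≼P (P≤u , u-least) =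
    ≼-upperBound Q≼P P≤u , λ v Q≤v → u-least v (≼-upperBound P≼Q Q≤v)

  IsSup-resp-≈ : {P : Subset} {u v : Carrier} → IsSup P u → u ≈ v → IsSup P v
  IsSup-resp-≈ (P≤u , u-least) (u≤v , v≤u) =
    (λ a a∈P → ≤-trans (P≤u a a∈P) u≤v) , λ w P≤w → ≤-trans v≤u (u-least w P≤w)

module Approximations (S : Sig) (A : OAlg S) where
  open Sig S
  open Coterms S
  open OAlg A
  open OrderedAlgebra S A public

  eval-≪ : ∀ {V} (env : V → Carrier) {s u : FT S V} → s ≪ᶠ u → eval env s ≤ eval env u
  eval-≪ env ⊥≪ = ⊥-min _
  eval-≪ env var≪ = ≤-refl _
  eval-≪ env (node≪ {f} p) = op-mono f _ _ (λ i → eval-≪ env (p i))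

  chain : ∀ {V} (env : V → Carrier) (t : CT S V) → ℕ → Carrier
  chain env t n = eval env (approx t n)

  chain-≤-suc : ∀ {V} (env : V → Carrier) (t : CT S V) n → chain env t n ≤ chain env t (suc n)
  chain-≤-suc env t n = eval-≪ env (approx-≪-suc t n)

  chain-directed : ∀ {V} (env : V → Carrier) (t : CT S V) → Directed (chain env t)
  chain-directed env t m n = m ⊔ n , mono (m≤m⊔n m n) , mono (m≤n⊔m m n)
    where
    mono = steps⇒mono _≤_ ≤-refl ≤-trans (chain env t) (chain-≤-suc env t)

  Approx-chain : ∀ {V} (env : V → Carrier) (t : CT S V) n → Approx env t (chain env t n)
  Approx-chain env t n = approx t n , (n , ≪-refl _) , refl

  Approx-≤-chain : ∀ {V} (env : V → Carrier) (t : CT S V) {a} →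
                   Approx env t a → ∃[ n ] (a ≤ chain env t n)
  Approx-≤-chain env t (s , (n , s≪) , refl) = n , eval-≪ env s≪

  Approx≼chain : ∀ {V} (env : V → Carrier) (t : CT S V) → Approx env t ≼ Im (chain env t)
  Approx≼chain env t a a∈ with Approx-≤-chain env t a∈
  ... | n , a≤ = chain env t n , (n , refl) , a≤

  chain≼Approx : ∀ {V} (env : V → Carrier) (t : CT S V) → Im (chain env t) ≼ Approx env t
  chain≼Approx env t = ⊆⇒≼ λ { a (n , refl) → Approx-chain env t n }

  sup-chain⇒sup-Approx : ∀ {V} (env : V → Carrier) (t : CT S V) {u} →
                         IsSup (Im (chain env t)) u → IsSup (Approx env t) u
  sup-chain⇒sup-Approx env t = IsSup-cofinal (chain≼Approx env t) (Approx≼chain env t)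

  sup-Approx⇒sup-chain : ∀ {V} (env : V → Carrier) (t : CT S V) {u} →
                         IsSup (Approx env t) u → IsSup (Im (chain env t)) u
  sup-Approx⇒sup-chain env t = IsSup-cofinal (Approx≼chain env t) (chain≼Approx env t)

  chain-cofinal⇒Approx≼ : ∀ {V} (env : V → Carrier) (t t' : CT S V) →
                          (∀ n → ∃[ m ] (chain env t n ≤ chain env t' m)) →
                          Approx env t ≼ Approx env t'
  chain-cofinal⇒Approx≼ env t t' cofinal a a∈ with Approx-≤-chain env t a∈
  ... | n , a≤ with cofinal n
  ... | m , ≤chain = chain env t' m , Approx-chain env t' m , ≤-trans a≤ ≤chain

  Approx-mono-⊑ : ∀ {V} (env : V → Carrier) {T₁ T₂ : CT S V} →
                  T₁ ⊑ᶜ T₂ → Approx env T₁ ⊆ Approx env T₂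
  Approx-mono-⊑ env T₁⊑T₂ a (s , s≪ , a≡) = s , ≪ᶜ-⊑-trans s≪ T₁⊑T₂ , a≡

  sup-resp-≈ᶜ : ∀ {V} (env : V → Carrier) {T₁ T₂ : CT S V} {u} → T₁ ≈ᶜ T₂ →
                IsSup (Approx env T₁) u → IsSup (Approx env T₂) u
  sup-resp-≈ᶜ env T₁≈T₂ =
    IsSup-cofinal (⊆⇒≼ (Approx-mono-⊑ env (≈⇒⊑ T₁≈T₂)))
                  (⊆⇒≼ (Approx-mono-⊑ env (≈⇒⊑ (≈ᶜ-sym T₁≈T₂))))

  Approx-mono-env : ∀ {V} {env env' : V → Carrier} → (∀ v → env v ≤ env' v) → (t : CT S V) →
                    Approx env t ≼ Approx env' t
  Approx-mono-env {env' = env'} env≤ t a (s , s≪ , refl) =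
    eval env' s , (s , s≪ , refl) , eval-mono-env env≤ s

  sup-resp-env : ∀ {V} {env env' : V → Carrier} → (∀ v → env v ≈ env' v) →
                 ∀ t {u} → IsSup (Approx env t) u → IsSup (Approx env' t) u
  sup-resp-env env≈ t =
    IsSup-cofinal (Approx-mono-env (λ v → proj₁ (env≈ v)) t)
                  (Approx-mono-env (λ v → proj₂ (env≈ v)) t)

  NodeSet : ∀ {V} (env : V → Carrier) (f : Op) → (Fin (ar f) → CT S V) → Subset
  NodeSet env f ts = OpImage f (λ i → Approx env (ts i))

  ⊥∈Approx : ∀ {V} (env : V → Carrier) (t : CT S V) → Approx env t ⊥
  ⊥∈Approx env t = ⊥t , (0 , ⊥≪) , refl

  Approx-node≼NodeSet : ∀ {V} (env : V → Carrier) f (ts : Fin (ar f) → CT S V) →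
                        Approx env (nodeCT S f ts) ≼ NodeSet env f ts
  Approx-node≼NodeSet env f ts a (⊥t , _ , refl) =
    op f (λ _ → ⊥) , ((λ _ → ⊥) , (λ i → ⊥∈Approx env (ts i)) , refl) , ⊥-min _
  Approx-node≼NodeSet env f ts a (var x , (zero , ()) , _)
  Approx-node≼NodeSet env f ts a (var x , (suc n , ()) , _)
  Approx-node≼NodeSet env f ts a (node .f ss , (suc n , node≪ ss≪) , refl) =
    a , ((λ i → eval env (ss i)) , (λ i → ss i , (n , ss≪ i) , refl) , refl) , ≤-refl a

  NodeSet≼Approx-node : ∀ {V} (env : V → Carrier) f (ts : Fin (ar f) → CT S V) →
                        NodeSet env f ts ≼ Approx env (nodeCT S f ts)
  NodeSet≼Approx-node env f ts a (bs , bs∈ , refl)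
    with ≪ᶜ-common-level {ts = ts} (λ i → proj₁ (proj₂ (bs∈ i)))
  ... | N , ss≪ = eval env (node f ss) , (node f ss , (suc N , node≪ ss≪) , refl) ,
                  op-mono f _ _ (λ i → ≡⇒≤ (proj₂ (proj₂ (bs∈ i))))
    where
    ss : Fin (ar f) → FT S _
    ss i = proj₁ (bs∈ i)

  sup-NodeSet⇒sup-Approx-node : ∀ {V} (env : V → Carrier) f (ts : Fin (ar f) → CT S V) {u} →
                                IsSup (NodeSet env f ts) u → IsSup (Approx env (nodeCT S f ts)) u
  sup-NodeSet⇒sup-Approx-node env f ts =
    IsSup-cofinal (NodeSet≼Approx-node env f ts) (Approx-node≼NodeSet env f ts)

  sup-Approx-leaf : ∀ {V} (env : V → Carrier) x → IsSup (Approx env (leaf S x)) (env x)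
  sup-Approx-leaf env x = ub , λ v ub' → ub' (env x) (var x , (1 , var≪) , refl)
    where
    ub : UpperBound (Approx env (leaf S x)) (env x)
    ub a (s , (zero , ⊥≪) , refl) = ⊥-min _
    ub a (s , (suc n , ⊥≪) , refl) = ⊥-min _
    ub a (s , (suc n , var≪) , refl) = ≤-refl _

  sup-Approx-fin : ∀ {V} (env : V → Carrier) s → IsSup (Approx env (fin s)) (eval env s)
  sup-Approx-fin env s = ub , λ v ub' → ub' (eval env s) (s , ≪-fin s , refl)
    where
    ub : UpperBound (Approx env (fin s)) (eval env s)
    ub a (u , (n , u≪) , refl) = eval-≪ env (≪-trans u≪ (trunc-≪ n s))

  sup-Approx-⊥ : ∀ {V} (env : V → Carrier) → IsSup (Approx env (⊥CT S)) ⊥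
  sup-Approx-⊥ env = ub , λ v ub' → ub' ⊥ (⊥∈Approx env (⊥CT S))
    where
    ub : UpperBound (Approx env (⊥CT S)) ⊥
    ub a (s , (zero , ⊥≪) , refl) = ≤-refl _
    ub a (s , (suc n , ⊥≪) , refl) = ≤-refl _

  eval-cut-subT-≤ : ∀ {V W} (env₀ : W → Carrier) (σ : V → CT S W) (env : V → Carrier) →
                    (∀ v → UpperBound (Approx env₀ (σ v)) (env v)) →
                    ∀ n (s : FT S V) {u} → u ≪ᶠ subT S n σ s → eval env₀ u ≤ eval env s
  eval-cut-subT-≤ env₀ σ env σ≤env zero s ⊥≪ = ⊥-min _
  eval-cut-subT-≤ env₀ σ env σ≤env (suc n) ⊥t ⊥≪ = ⊥-min _
  eval-cut-subT-≤ env₀ σ env σ≤env (suc n) (var v) {u} u≪ = σ≤env v _ (u , (suc n , u≪) , refl)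
  eval-cut-subT-≤ env₀ σ env σ≤env (suc n) (node f ss) ⊥≪ = ⊥-min _
  eval-cut-subT-≤ env₀ σ env σ≤env (suc n) (node f ss) (node≪ p) =
    op-mono f _ _ (λ i → eval-cut-subT-≤ env₀ σ env σ≤env n (ss i) (p i))

  eval-≤-subT : ∀ {V W} (env₀ : W → Carrier) (σ : V → CT S W) (env : V → Carrier) →
                (∀ v → ∃[ d ] (env v ≤ chain env₀ (σ v) d)) →
                ∀ (s : FT S V) → ∃[ N ] (eval env s ≤ eval env₀ (subT S N σ s))
  eval-≤-subT env₀ σ env env≤σ ⊥t = 0 , ⊥-min _
  eval-≤-subT env₀ σ env env≤σ (var v) with env≤σ v
  ... | d , env≤ = suc d , ≤-trans env≤ (eval-≪ env₀ (approx-mono (σ v) (n≤1+n d)))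
  eval-≤-subT env₀ σ env env≤σ (node f ss) =
    suc (maxᶠ N) ,
    op-mono f _ _ (λ i → ≤-trans (proj₂ (IH i))
                                 (eval-≪ env₀ (subT-mono-depth σ (ss i) (≤-maxᶠ N i))))
    where
    IH : ∀ i → ∃[ N ] (eval env (ss i) ≤ eval env₀ (subT S N σ (ss i)))
    IH i = eval-≤-subT env₀ σ env env≤σ (ss i)
    N : Fin (ar f) → ℕ
    N i = proj₁ (IH i)

  Approx-subst≼Approx : ∀ {V W} (env₀ : W → Carrier) (σ : V → CT S W) (env : V → Carrier) →
                        (∀ v → UpperBound (Approx env₀ (σ v)) (env v)) →
                        ∀ T → Approx env₀ (subst S σ T) ≼ Approx env T
  Approx-subst≼Approx env₀ σ env σ≤env T a (u , (n , u≪) , refl) =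
    chain env T n , Approx-chain env T n , eval-cut-subT-≤ env₀ σ env σ≤env n (approx T n) u≪

  Approx≼Approx-subst : ∀ {V W} (env₀ : W → Carrier) (σ : V → CT S W) (env : V → Carrier) →
                        (∀ v → ∃[ d ] (env v ≤ chain env₀ (σ v) d)) →
                        ∀ T → Approx env T ≼ Approx env₀ (subst S σ T)
  Approx≼Approx-subst env₀ σ env env≤σ T a (s , (n , s≪) , refl)
    with eval-≤-subT env₀ σ env env≤σ s
  ... | N , s≤ =
    chain env₀ (subst S σ T) (N ⊔ n) , Approx-chain env₀ (subst S σ T) (N ⊔ n) ,
    ≤-trans s≤ (eval-≪ env₀ (≪-trans (subT-mono-depth σ s (m≤m⊔n N n))
                                     (subT-mono-≪ σ (N ⊔ n) s≪approx)))
    where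
    s≪approx : s ≪ᶠ approx T (N ⊔ n)
    s≪approx = ≪-trans s≪ (approx-mono T (m≤n⊔m N n))

  Approx-map≼Approx : ∀ {V W} (env : W → Carrier) (g : V → W) (t : CT S V) →
                      Approx env (mapCT S g t) ≼ Approx (λ v → env (g v)) t
  Approx-map≼Approx env g =
    Approx-subst≼Approx env (λ v → leaf S (g v)) (λ v → env (g v))
                        (λ v → proj₁ (sup-Approx-leaf env (g v)))

  Approx≼Approx-map : ∀ {V W} (env : W → Carrier) (g : V → W) (t : CT S V) →
                      Approx (λ v → env (g v)) t ≼ Approx env (mapCT S g t)
  Approx≼Approx-map env g =
    Approx≼Approx-subst env (λ v → leaf S (g v)) (λ v → env (g v)) (λ v → 1 , ≤-refl _)

  sup-Approx-map : ∀ {V W} (env : W → Carrier) (g : V → W) (t : CT S V) {u} →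
                   IsSup (Approx env (mapCT S g t)) u → IsSup (Approx (λ v → env (g v)) t) u
  sup-Approx-map env g t = IsSup-cofinal (Approx-map≼Approx env g t) (Approx≼Approx-map env g t)

  OpPreservesSups : ∀ {W} → (CT S W → Set) → (W → Carrier) → Set
  OpPreservesSups {W} P env₀ =
    ∀ f (ts : Fin (ar f) → CT S W) (us : Fin (ar f) → Carrier) → (∀ i → P (ts i)) →
    (∀ i → IsSup (Approx env₀ (ts i)) (us i)) → IsSup (NodeSet env₀ f ts) (op f us)

  -- op-sup is only needed at the coterms subst τ (fin s): a Δ-algebra preserves just the suprema of
  -- Δ-sets, and these coterms lie in Δ.
  module SubstitutionLemma {V W : Set} (env₀ : W → Carrier) (P : CT S W → Set)
    (op-sup : OpPreservesSups P env₀)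
    (τ : V → CT S W) (P-τ : ∀ s → P (subst S τ (fin s)))
    (env : V → Carrier) (env-sup : ∀ v → IsSup (Approx env₀ (τ v)) (env v)) where

    sup-subst-fin : ∀ s → IsSup (Approx env₀ (subst S τ (fin s))) (eval env s)
    sup-subst-fin ⊥t = sup-resp-≈ᶜ env₀ (≈ᶜ-sym (subst-fin-⊥ τ)) (sup-Approx-⊥ env₀)
    sup-subst-fin (var v) = sup-resp-≈ᶜ env₀ (≈ᶜ-sym (subst-fin-var τ v)) (env-sup v)
    sup-subst-fin (node f ss) =
      sup-resp-≈ᶜ env₀ (≈ᶜ-sym (subst-fin-node τ f ss))
        (sup-NodeSet⇒sup-Approx-node env₀ f ts
          (op-sup f ts (λ i → eval env (ss i)) (λ i → P-τ (ss i)) (λ i → sup-subst-fin (ss i))))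
      where
      ts : Fin (ar f) → CT S W
      ts i = subst S τ (fin (ss i))

    sup-subst⇒sup : ∀ T {u} → IsSup (Approx env₀ (subst S τ T)) u → IsSup (Approx env T) u
    sup-subst⇒sup T {u} (≤u , u-least) = ub , λ v T≤v → u-least v (≼-upperBound subst≼ T≤v)
      where
      subst≼ : Approx env₀ (subst S τ T) ≼ Approx env T
      subst≼ = Approx-subst≼Approx env₀ τ env (λ v → proj₁ (env-sup v)) T
      ub : UpperBound (Approx env T) u
      ub a (s , s≪ , refl) =
        proj₂ (sup-subst-fin s) u (λ b b∈ → ≤u b (Approx-mono-⊑ env₀ subst⊑ b b∈))
        where
        subst⊑ : subst S τ (fin s) ⊑ᶜ subst S τ T
        subst⊑ = subst-mono τ (≪ᶜ⇒fin-⊑ {T = T} s≪)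

  module Continuous (ωA : IsOmegaCont S A) where
    open IsOmegaCont ωA

    sup-Approx : ∀ {V} (env : V → Carrier) (t : CT S V) → ∃[ u ] IsSup (Approx env t) u
    sup-Approx env t with sup-exists (chain env t) (chain-directed env t)
    ... | u , u-sup = u , sup-chain⇒sup-Approx env t u-sup

    op-sup-Approx : ∀ {V} (env₀ : V → Carrier) → OpPreservesSups (λ _ → ⊤) env₀
    op-sup-Approx env₀ f ts us _ us-sup =
      IsSup-cofinal Chains≼NodeSet NodeSet≼Chains
        (op-sup f cs us (λ i → chain-directed env₀ (ts i))
           (λ i → sup-Approx⇒sup-chain env₀ (ts i) (us-sup i)))
      where
      cs : Fin (ar f) → ℕ → Carrier
      cs i = chain env₀ (ts i)
      Chains : Subset
      Chains a = Σ (Fin (ar f) → ℕ) λ ks → a ≡ op f (λ i → cs i (ks i))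
      Chains≼NodeSet : Chains ≼ NodeSet env₀ f ts
      Chains≼NodeSet = ⊆⇒≼ λ where
        a (ks , a≡) → (λ i → cs i (ks i)) , (λ i → Approx-chain env₀ (ts i) (ks i)) , a≡
      NodeSet≼Chains : NodeSet env₀ f ts ≼ Chains
      NodeSet≼Chains a (bs , bs∈ , refl) =
        op f (λ i → cs i (ks i)) , (ks , refl) , op-mono f _ _ (λ i → proj₂ (bs≤ i))
        where
        bs≤ : ∀ i → ∃[ k ] (bs i ≤ cs i k)
        bs≤ i = Approx-≤-chain env₀ (ts i) (bs∈ i)
        ks : Fin (ar f) → ℕ
        ks i = proj₁ (bs≤ i)

module ChainAlgebra (S : Sig) (A : OAlg S) where
  open Sig S
  open OAlg A
  open OrderedAlgebra S A using (≈-refl; eval-hom)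

  record Chain : Set where
    constructor mkChain
    field
      val       : ℕ → Carrier
      val-≤-suc : ∀ n → val n ≤ val (suc n)

    val-mono : ∀ {m n} → m ≤ℕ n → val m ≤ val n
    val-mono = steps⇒mono _≤_ ≤-refl ≤-trans val val-≤-suc
  open Chain

  infix 4 _⊴_
  record _⊴_ (c d : Chain) : Set where
    constructor mk⊴
    field un⊴ : ∀ n → ∃[ m ] (val c n ≤ val d m)
  open _⊴_ public

  ⊴-trans : ∀ {c d e} → c ⊴ d → d ⊴ e → c ⊴ e
  ⊴-trans (mk⊴ c⊴d) (mk⊴ d⊴e) = mk⊴ go
    where
    go : ∀ n → ∃[ k ] (_ ≤ _)
    go n with c⊴d n
    ... | m , c≤d with d⊴e m
    ... | k , d≤e = k , ≤-trans c≤d d≤e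

  same-val⇒⊴ : ∀ {c d} → (∀ n → val c n ≡ val d n) → c ⊴ d
  same-val⇒⊴ c≡d = mk⊴ (λ n → n , ≤-reflexive (c≡d n))
    where
    ≤-reflexive : ∀ {a b} → a ≡ b → a ≤ b
    ≤-reflexive refl = ≤-refl _

  const : Carrier → Chain
  const a = mkChain (λ _ → a) (λ _ → ≤-refl a)

  opᶜ : (f : Op) → (Fin (ar f) → Chain) → Chain
  opᶜ f cs = mkChain (λ n → op f (λ i → val (cs i) n))
                     (λ n → op-mono f _ _ (λ i → val-≤-suc (cs i) n))

  const-op : ∀ f (as : Fin (ar f) → Carrier) → const (op f as) ⊴ opᶜ f (λ i → const (as i)) ×
                                                 opᶜ f (λ i → const (as i)) ⊴ const (op f as)
  const-op f as = same-val⇒⊴ (λ n → refl) , same-val⇒⊴ (λ n → refl)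

  opᶜ-mono : ∀ f (cs ds : Fin (ar f) → Chain) → (∀ i → cs i ⊴ ds i) → opᶜ f cs ⊴ opᶜ f ds
  opᶜ-mono f cs ds cs⊴ds = mk⊴ λ n →
    maxᶠ (level n) ,
    op-mono f _ _ (λ i → ≤-trans (proj₂ (un⊴ (cs⊴ds i) n)) (val-mono (ds i) (≤-maxᶠ (level n) i)))
    where
    level : ℕ → Fin (ar f) → ℕ
    level n i = proj₁ (un⊴ (cs⊴ds i) n)

  ChainAlg : OAlg S
  ChainAlg = mkOAlg Chain _⊴_ (record
    { ≤-refl = λ c → same-val⇒⊴ (λ n → refl)
    ; ≤-trans = ⊴-trans
    ; ⊥ = const ⊥
    ; ⊥-min = λ c → mk⊴ (λ n → 0 , ⊥-min _)
    ; op = opᶜ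
    ; op-mono = opᶜ-mono
    })

  private module Ch = OAlg ChainAlg

  val-eval : ∀ {V} (env : V → Chain) s n → val (Ch.eval env s) n ≈ eval (λ v → val (env v) n) s
  val-eval env s n = eval-hom ChainAlg (λ c → val c n) (≈-refl _) (λ f cs → ≈-refl _) env s

  ChainAlg-sat : (E : FT S ℕ → FT S ℕ → Set) → Sat S E A → Sat S E ChainAlg
  ChainAlg-sat E satA l r l⊑r env = mk⊴ λ n →
    n , ≤-trans (proj₁ (val-eval env l n)) (≤-trans (satA l r l⊑r _) (proj₂ (val-eval env r n)))

  -- The supremum of a directed family of chains is read off along a diagonal of positions (k , m),
  -- each standing for the element val (C k) m.
  module DirectedSup (C : ℕ → Chain) (dir : Ch.Directed C) where
    Pos : Set
    Pos = ℕ × ℕ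

    at : Pos → Carrier
    at (k , m) = val (C k) m

    bound : ℕ → ℕ → ℕ
    bound k j = proj₁ (dir k j)

    ⊴-boundˡ : ∀ k j → C k ⊴ C (bound k j)
    ⊴-boundˡ k j = proj₁ (proj₂ (dir k j))

    ⊴-boundʳ : ∀ k j → C j ⊴ C (bound k j)
    ⊴-boundʳ k j = proj₂ (proj₂ (dir k j))

    upper : Pos → Pos → Pos
    upper (k , m) (j , n) = bound k j , proj₁ (un⊴ (⊴-boundˡ k j) m) ⊔ proj₁ (un⊴ (⊴-boundʳ k j) n)

    ≤-upperˡ : ∀ p q → at p ≤ at (upper p q)
    ≤-upperˡ (k , m) (j , n) =
      ≤-trans (proj₂ (un⊴ (⊴-boundˡ k j) m)) (val-mono (C (bound k j)) (m≤m⊔n _ _))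

    ≤-upperʳ : ∀ p q → at q ≤ at (upper p q)
    ≤-upperʳ (k , m) (j , n) =
      ≤-trans (proj₂ (un⊴ (⊴-boundʳ k j) n)) (val-mono (C (bound k j)) (m≤n⊔m _ _))

    upperRow : Pos → ℕ → ℕ → Pos
    upperRow p n zero = upper p (0 , n)
    upperRow p n (suc j) = upper (upperRow p n j) (suc j , n)

    ≤-upperRow : ∀ p n j → at p ≤ at (upperRow p n j)
    ≤-upperRow p n zero = ≤-upperˡ p (0 , n)
    ≤-upperRow p n (suc j) = ≤-trans (≤-upperRow p n j) (≤-upperˡ (upperRow p n j) (suc j , n))

    row-≤-upperRow : ∀ p n j {i} → i ≤ℕ j → at (i , n) ≤ at (upperRow p n j)
    row-≤-upperRow p n zero z≤n = ≤-upperʳ p (0 , n)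
    row-≤-upperRow p n (suc j) i≤1+j with m≤n⇒m<n∨m≡n i≤1+j
    ... | inj₁ (s≤s i≤j) =
      ≤-trans (row-≤-upperRow p n j i≤j) (≤-upperˡ (upperRow p n j) (suc j , n))
    ... | inj₂ refl = ≤-upperʳ (upperRow p n j) (suc j , n)

    diag : ℕ → Pos
    diag zero = 0 , 0
    diag (suc n) = upperRow (diag n) n n

    diagonal : Chain
    diagonal = mkChain (λ n → at (diag n)) (λ n → ≤-upperRow (diag n) n n)

    C⊴diagonal : ∀ j → C j ⊴ diagonal
    C⊴diagonal j = mk⊴ λ i →
      suc (i ⊔ j) ,
      ≤-trans (val-mono (C j) (m≤m⊔n i j))
              (row-≤-upperRow (diag (i ⊔ j)) (i ⊔ j) (i ⊔ j) (m≤n⊔m i j))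

    diagonal-sup : Ch.IsSup (Ch.Im C) diagonal
    diagonal-sup =
      (λ { _ (k , refl) → C⊴diagonal k }) ,
      (λ v C⊴v → mk⊴ λ n →
         un⊴ (C⊴v (C (proj₁ (diag n))) (proj₁ (diag n) , refl)) (proj₂ (diag n)))

    sup-below-position : ∀ w → Ch.IsSup (Ch.Im C) w → ∀ n → ∃[ p ] (val w n ≤ at p)
    sup-below-position w (_ , w-least) n with un⊴ (w-least diagonal (proj₁ diagonal-sup)) n
    ... | m , w≤ = diag m , w≤

  ChainAlg-ωcont : IsOmegaCont S ChainAlg
  ChainAlg-ωcont = record
    { sup-exists = λ C dir → DirectedSup.diagonal C dir , DirectedSup.diagonal-sup C dir
    ; op-sup = op-sup
    }
    where
    op-sup : ∀ f (cs : Fin (ar f) → ℕ → Chain) (us : Fin (ar f) → Chain) →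
             (∀ i → Ch.Directed (cs i)) → (∀ i → Ch.IsSup (Ch.Im (cs i)) (us i)) →
             Ch.IsSup (λ a → Σ (Fin (ar f) → ℕ) λ ks → a ≡ opᶜ f (λ i → cs i (ks i))) (opᶜ f us)
    op-sup f cs us dir us-sup = ub , least
      where
      Joins : Chain → Set
      Joins a = Σ (Fin (ar f) → ℕ) λ ks → a ≡ opᶜ f (λ i → cs i (ks i))
      ub : ∀ a → Joins a → a ⊴ opᶜ f us
      ub a (ks , refl) = opᶜ-mono f _ us (λ i → proj₁ (us-sup i) (cs i (ks i)) (ks i , refl))
      least : ∀ v → (∀ a → Joins a → a ⊴ v) → opᶜ f us ⊴ v
      least v ≤v = mk⊴ λ n → proj₁ (above n) , ≤-trans (op-mono f _ _ (us≤ n)) (proj₂ (above n))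
        where
        below : ∀ n i → ∃[ p ] (val (us i) n ≤ DirectedSup.at (cs i) (dir i) p)
        below n i = DirectedSup.sup-below-position (cs i) (dir i) (us i) (us-sup i) n
        ks ms : ℕ → Fin (ar f) → ℕ
        ks n i = proj₁ (proj₁ (below n i))
        ms n i = proj₂ (proj₁ (below n i))
        us≤ : ∀ n i → val (us i) n ≤ val (cs i (ks n i)) (maxᶠ (ms n))
        us≤ n i = ≤-trans (proj₂ (below n i)) (val-mono (cs i (ks n i)) (≤-maxᶠ (ms n) i))
        above : ∀ n → ∃[ m ] (val (opᶜ f (λ i → cs i (ks n i))) (maxᶠ (ms n)) ≤ val v m)
        above n = un⊴ (≤v (opᶜ f (λ i → cs i (ks n i))) (ks n , refl)) (maxᶠ (ms n))

module FreeOmegaComparison (S : Sig) (E : FT S ℕ → FT S ℕ → Set) (X : Set)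
  (Fω : OAlg S) (ηω : X → Car S Fω) (FO : FreeOmega S E X Fω ηω)
  (A : OAlg S) (satA : Sat S E A) (h : X → Car S A) where

  open Sig S
  open ChainAlgebra S A
  private
    module Fω = OAlg Fω
    module Fωᵃ = Approximations S Fω
    module A = OAlg A
    module Aᵃ = Approximations S A
    module Ch = OAlg ChainAlg
    module Chᵃ = OrderedAlgebra S ChainAlg

    extension = FreeOmega.univ FO ChainAlg ChainAlg-ωcont (ChainAlg-sat E satA) (λ x → const (h x))

  G : Fω.Carrier → Chain
  G = proj₁ extension

  private
    module G = IsOmegaMor (proj₁ (proj₂ extension))
    module Gᵐ = IsMor G.isMor

    G-ηω : ∀ x → G (ηω x) Ch.≈ const (h x)
    G-ηω = proj₁ (proj₂ (proj₂ extension))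

  G-eval : ∀ s → G (Fω.eval ηω s) Ch.≈ const (A.eval h s)
  G-eval s =
    Chᵃ.≈-trans (Chᵃ.eval-hom Fω G Gᵐ.strict Gᵐ.hom ηω s)
      (Chᵃ.≈-trans (Chᵃ.eval-resp-env G-ηω s)
                   (Chᵃ.≈-sym (Chᵃ.eval-hom A const (Chᵃ.≈-refl _) const-op h s)))

  chainᴬ : CT S X → Chain
  chainᴬ t = mkChain (Aᵃ.chain h t) (Aᵃ.chain-≤-suc h t)

  G-sup : ∀ (t : CT S X) {a} → Fω.IsSup (Fω.Approx ηω t) a → G a Ch.≈ chainᴬ t
  G-sup t {a} a-sup = proj₂ Ga-sup (chainᴬ t) ub , chain⊴Ga
    where
    Ga-sup : Ch.IsSup (Ch.Im (λ n → G (Fωᵃ.chain ηω t n))) (G a)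
    Ga-sup = G.cont (Fωᵃ.chain ηω t) a (Fωᵃ.chain-directed ηω t)
               (Fωᵃ.sup-Approx⇒sup-chain ηω t a-sup)
    ub : ∀ c → Ch.Im (λ n → G (Fωᵃ.chain ηω t n)) c → c ⊴ chainᴬ t
    ub c (n , refl) = ⊴-trans (proj₁ (G-eval (approx t n))) (mk⊴ (λ _ → n , A.≤-refl _))
    chain⊴Ga : chainᴬ t ⊴ G a
    chain⊴Ga = mk⊴ λ n → un⊴ (⊴-trans (proj₂ (G-eval (approx t n))) (proj₁ Ga-sup _ (n , refl))) 0

  ≤⇒Approx≼ : ∀ t t' {a a'} → Fω.IsSup (Fω.Approx ηω t) a → Fω.IsSup (Fω.Approx ηω t') a' →
              a Fω.≤ a' → A.Approx h t Aᵃ.≼ A.Approx h t'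
  ≤⇒Approx≼ t t' a-sup a'-sup a≤a' =
    Aᵃ.chain-cofinal⇒Approx≼ h t t'
      (un⊴ (⊴-trans (proj₂ (G-sup t a-sup)) (⊴-trans (Gᵐ.mono a≤a') (proj₁ (G-sup t' a'-sup)))))

module FreeDeltaAlgebra (S : Sig) (QR : QuasiRegular S) (E : FT S ℕ → FT S ℕ → Set) (X : Set)
  (Fω : OAlg S) (ηω : X → Car S Fω) (FO : FreeOmega S E X Fω ηω) (F : OAlg S) (η : X → Car S F) where

  open Sig S
  open QuasiRegular QR
  open Coterms S
  open QuasiRegularProperties S QR
  private
    module Fω = OAlg Fω
    module Fωᵃ = Approximations S Fω
    module Fωᶜ = Fωᵃ.Continuous (FreeOmega.F-cont FO)

  R : Set
  R = RCarrier S QR E X Fω ηω F η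

  value : R → Fω.Carrier
  value = proj₁

  term : R → CT S X
  term r = proj₁ (proj₂ r)

  term∈Δ : ∀ r → Δ X (term r)
  term∈Δ r = proj₁ (proj₂ (proj₂ r))

  value-sup : ∀ r → Fω.IsSup (Fω.Approx ηω (term r)) (value r)
  value-sup r = proj₂ (proj₂ (proj₂ r))

  fromTerm : (t : CT S X) → Δ X t → R
  fromTerm t t∈Δ = proj₁ (Fωᶜ.sup-Approx ηω t) , t , t∈Δ , proj₂ (Fωᶜ.sup-Approx ηω t)

  opᴿ : (f : Op) → (Fin (ar f) → R) → R
  opᴿ f rs =
    Fω.op f (λ i → value (rs i)) , nodeCT S f ts , Δ-node f ts (λ i → term∈Δ (rs i)) ,
    Fωᵃ.sup-NodeSet⇒sup-Approx-node ηω f ts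
      (Fωᶜ.op-sup-Approx ηω f ts (λ i → value (rs i)) _ (λ i → value-sup (rs i)))
    where
    ts : Fin (ar f) → CT S X
    ts i = term (rs i)

  Rstr : IsOAlg S R (_≤R_ S QR E X Fω ηω F η)
  Rstr = record
    { ≤-refl = λ r → Fω.≤-refl (value r)
    ; ≤-trans = Fω.≤-trans
    ; ⊥ = Fω.⊥ , ⊥CT S , Δ-⊥ , Fωᵃ.sup-Approx-⊥ ηω
    ; ⊥-min = λ r → Fω.⊥-min (value r)
    ; op = opᴿ
    ; op-mono = λ f rs rs' → Fω.op-mono f _ _
    }

  RA : OAlg S
  RA = RAlg S QR E X Fω ηω F η Rstr

  private
    module R = OAlg RA
    module Rᵃ = OrderedAlgebra S RA

  ηᴿ : X → R
  ηᴿ x = ηω x , leaf S x , Δ-var x , Fωᵃ.sup-Approx-leaf ηω x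

  value-eval : ∀ {V} (env : V → R) s → value (R.eval env s) Fω.≈ Fω.eval (λ v → value (env v)) s
  value-eval = Fωᵃ.eval-hom RA value (Fωᵃ.≈-refl _) (λ f rs → Fωᵃ.≈-refl _)

  R-sat : Sat S E RA
  R-sat = Fωᵃ.sat-reflect RA value (Fωᵃ.≈-refl _) (λ f rs → Fωᵃ.≈-refl _) E (λ r≤r' → r≤r')
                          (FreeOmega.F-sat FO)

  IsSup-value : {P : R → Set} {Q : Fω.Carrier → Set} {r : R} →
                (∀ a → P a → ∃[ b ] (Q b × value a Fω.≤ b)) →
                (∀ b → Q b → ∃[ a ] (P a × b Fω.≤ value a)) →
                Fω.IsSup Q (value r) → R.IsSup P r
  IsSup-value P≼Q Q≼P (Q≤r , r-least) =
    (λ a a∈P → let (b , b∈Q , a≤b) = P≼Q a a∈P in Fω.≤-trans a≤b (Q≤r b b∈Q)) ,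
    (λ v P≤v → r-least (value v) λ b b∈Q →
       let (a , a∈P , b≤a) = Q≼P b b∈Q in Fω.≤-trans b≤a (P≤v a a∈P))

  DSet→Approx-value : ∀ T {a} → R.DSet T a → ∃[ b ] (Fω.Approx value T b × value a Fω.≤ b)
  DSet→Approx-value T (s , s≪ , refl) =
    Fω.eval value s , (s , s≪ , refl) , proj₁ (value-eval (λ r → r) s)

  Approx-value→DSet : ∀ T {b} → Fω.Approx value T b → ∃[ a ] (R.DSet T a × b Fω.≤ value a)
  Approx-value→DSet T (s , s≪ , refl) =
    R.eval (λ r → r) s , (s , s≪ , refl) , proj₂ (value-eval (λ r → r) s)

  αᴿ : (T : CT S R) → Δ R T → R
  αᴿ T T∈Δ = fromTerm (subst S term T) (Δ-subst term term∈Δ T T∈Δ)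

  private
    module Substᴿ =
      Fωᵃ.SubstitutionLemma ηω (λ _ → ⊤) (Fωᶜ.op-sup-Approx ηω) term (λ _ → tt) value value-sup

  value-α-sup : ∀ T T∈Δ → Fω.IsSup (Fω.Approx value T) (value (αᴿ T T∈Δ))
  value-α-sup T T∈Δ = Substᴿ.sup-subst⇒sup T (value-sup (αᴿ T T∈Δ))

  αᴿ-sup : ∀ T T∈Δ → R.IsSup (R.DSet T) (αᴿ T T∈Δ)
  αᴿ-sup T T∈Δ =
    IsSup-value {r = αᴿ T T∈Δ} (λ a → DSet→Approx-value T) (λ b → Approx-value→DSet T)
                (value-α-sup T T∈Δ)

  opᴿ-sup : ∀ f (ts : Fin (ar f) → CT S R) (us : Fin (ar f) → R) → (∀ i → Δ R (ts i)) →
            (∀ i → R.IsSup (R.DSet (ts i)) (us i)) →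
            R.IsSup (Rᵃ.OpImage f (λ i → R.DSet (ts i))) (opᴿ f us)
  opᴿ-sup f ts us ts∈Δ us-sup =
    IsSup-value {r = opᴿ f us} ops≼NodeSet NodeSet≼ops
      (Fωᶜ.op-sup-Approx value f ts (λ i → value (us i)) _ value-us-sup)
    where
    value-us-sup : ∀ i → Fω.IsSup (Fω.Approx value (ts i)) (value (us i))
    value-us-sup i =
      Fωᵃ.IsSup-resp-≈ (value-α-sup (ts i) (ts∈Δ i))
        (Rᵃ.sup-unique {R.DSet (ts i)} {αᴿ (ts i) (ts∈Δ i)} {us i}
                       (αᴿ-sup (ts i) (ts∈Δ i)) (us-sup i))
    ops≼NodeSet : ∀ a → Rᵃ.OpImage f (λ i → R.DSet (ts i)) a →
                  ∃[ b ] (Fωᵃ.NodeSet value f ts b × value a Fω.≤ b)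
    ops≼NodeSet a (bs , bs∈ , refl) =
      Fω.op f cs , (cs , (λ i → proj₁ (proj₂ (above i))) , refl) ,
      Fω.op-mono f _ _ (λ i → proj₂ (proj₂ (above i)))
      where
      above : ∀ i → ∃[ b ] (Fω.Approx value (ts i) b × value (bs i) Fω.≤ b)
      above i = DSet→Approx-value (ts i) (bs∈ i)
      cs : Fin (ar f) → Fω.Carrier
      cs i = proj₁ (above i)
    NodeSet≼ops : ∀ b → Fωᵃ.NodeSet value f ts b →
                  ∃[ a ] (Rᵃ.OpImage f (λ i → R.DSet (ts i)) a × b Fω.≤ value a)
    NodeSet≼ops b (cs , cs∈ , refl) =
      opᴿ f bs , (bs , (λ i → proj₁ (proj₂ (above i))) , refl) ,
      Fω.op-mono f _ _ (λ i → proj₂ (proj₂ (above i)))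
      where
      above : ∀ i → ∃[ a ] (R.DSet (ts i) a × cs i Fω.≤ value a)
      above i = Approx-value→DSet (ts i) (cs∈ i)
      bs : Fin (ar f) → R
      bs i = proj₁ (above i)

  RΔ : IsDeltaAlg S QR RA
  RΔ = record { α = αᴿ ; α-sup = αᴿ-sup ; op-sup = opᴿ-sup }

  termᴿ : R → CT S R
  termᴿ r = mapCT S ηᴿ (term r)

  termᴿ∈Δ : ∀ r → Δ R (termᴿ r)
  termᴿ∈Δ r = Δ-mapCT ηᴿ (term r) (term∈Δ r)

  α-termᴿ : ∀ r → αᴿ (termᴿ r) (termᴿ∈Δ r) R.≈ r
  α-termᴿ r =
    Fωᵃ.sup-unique (Fωᵃ.sup-resp-≈ᶜ ηω subst≈ (value-sup (αᴿ (termᴿ r) (termᴿ∈Δ r)))) (value-sup r)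
    where
    subst≈ : subst S term (termᴿ r) ≈ᶜ term r
    subst≈ = ≈ᶜ-trans (subst-subst (λ x → leaf S (ηᴿ x)) term (term r))
               (≈ᶜ-trans (subst-resp-σ (λ x → subst-leaf term (ηᴿ x)) (term r))
                         (subst-leaf-id (term r)))

  module Universal (A : OAlg S) (dA : IsDeltaAlg S QR A) (satA : Sat S E A) (h : X → Car S A) where
    private
      module A = OAlg A
      module Aᵃ = Approximations S A
      module dA = IsDeltaAlg dA
    open FreeOmegaComparison S E X Fω ηω FO A satA h using (≤⇒Approx≼)

    hᵀ : R → CT S A.Carrier
    hᵀ r = mapCT S h (term r)

    hᵀ∈Δ : ∀ r → Δ A.Carrier (hᵀ r)
    hᵀ∈Δ r = Δ-mapCT h (term r) (term∈Δ r)

    g : R → A.Carrier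
    g r = dA.α (hᵀ r) (hᵀ∈Δ r)

    g-sup : ∀ r → A.IsSup (A.DSet (hᵀ r)) (g r)
    g-sup r = dA.α-sup (hᵀ r) (hᵀ∈Δ r)

    g-sup-Approx : ∀ r → A.IsSup (A.Approx h (term r)) (g r)
    g-sup-Approx r = Aᵃ.sup-Approx-map (λ a → a) h (term r) (g-sup r)

    g-mono : ∀ {r r'} → r R.≤ r' → g r A.≤ g r'
    g-mono {r} {r'} r≤r' =
      Aᵃ.≼⇒sup-≤ {A.Approx h (term r)} {A.Approx h (term r')}
        (≤⇒Approx≼ (term r) (term r') (value-sup r) (value-sup r') r≤r') (g-sup-Approx r) (g-sup-Approx r')

    private
      module Substᴬ = Aᵃ.SubstitutionLemma (λ a → a) (Δ A.Carrier) dA.op-sup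
                        hᵀ (λ s → Δ-subst hᵀ hᵀ∈Δ (fin s) (Δ-fin s)) g g-sup

    g-α : ∀ T T∈Δ gT∈Δ → g (αᴿ T T∈Δ) A.≈ dA.α (mapCT S g T) gT∈Δ
    g-α T T∈Δ gT∈Δ =
      Aᵃ.sup-unique lhs-sup (Aᵃ.sup-Approx-map (λ a → a) g T (dA.α-sup (mapCT S g T) gT∈Δ))
      where
      lhs-sup : A.IsSup (A.Approx g T) (g (αᴿ T T∈Δ))
      lhs-sup =
        Substᴬ.sup-subst⇒sup T
          (Aᵃ.sup-resp-≈ᶜ (λ a → a) (subst-subst term (λ x → leaf S (h x)) T) (g-sup (αᴿ T T∈Δ)))

    g-mor : IsDeltaMor S QR RA RΔ A dA g
    g-mor = record
      { strict = Aᵃ.sup-unique (g-sup-Approx R.⊥) (Aᵃ.sup-Approx-⊥ h)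
      ; mono = λ {r} {r'} → g-mono {r} {r'}
      ; pres-α = g-α
      }

    g-ηᴿ : ∀ x → g (ηᴿ x) A.≈ h x
    g-ηᴿ x = Aᵃ.sup-unique (g-sup-Approx (ηᴿ x)) (Aᵃ.sup-Approx-leaf h x)

    g-unique : ∀ g' → IsDeltaMor S QR RA RΔ A dA g' → (∀ x → g' (ηᴿ x) A.≈ h x) →
               ∀ r → g' r A.≈ g r
    g-unique g' g'-mor g'-ηᴿ r =
      Aᵃ.≈-trans (g'.mono (proj₂ (α-termᴿ r)) , g'.mono (proj₁ (α-termᴿ r)))
        (Aᵃ.≈-trans (g'.pres-α (termᴿ r) (termᴿ∈Δ r) g'T∈Δ)
                    (Aᵃ.sup-unique g'-sup (g-sup-Approx r)))
      where
      module g' = IsDeltaMor g'-mor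
      g'T∈Δ = Δ-mapCT g' (termᴿ r) (termᴿ∈Δ r)
      g'-sup : A.IsSup (A.Approx h (term r)) (dA.α (mapCT S g' (termᴿ r)) g'T∈Δ)
      g'-sup =
        Aᵃ.sup-resp-env g'-ηᴿ (term r) (Aᵃ.sup-Approx-map g' ηᴿ (term r)
          (Aᵃ.sup-Approx-map (λ a → a) g' (termᴿ r) (dA.α-sup (mapCT S g' (termᴿ r)) g'T∈Δ)))

module IdealCompletion (S : Sig) (QR : QuasiRegular S) (E : FT S ℕ → FT S ℕ → Set) (X : Set)
  (Fω : OAlg S) (ηω : X → Car S Fω) (F : OAlg S) (η : X → Car S F) where

  open Sig S
  open QuasiRegular QR
  open Coterms S
  private
    module F = OAlg F
    module Fᵃ = Approximations S F
  open Fᵃ using (_⊆_)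

  I : Set
  I = CCarrier S QR E X Fω ηω F η

  IdealOf : CT S F.Carrier → F.Carrier → Set
  IdealOf T = F.↓ (F.DSet T)

  _≤ᴵ_ : I → I → Set
  _≤ᴵ_ = _≤C_ S QR E X Fω ηω F η

  DSet≼⇒Ideal⊆ : ∀ {T T'} → F.DSet T Fᵃ.≼ F.DSet T' → IdealOf T ⊆ IdealOf T'
  DSet≼⇒Ideal⊆ DSet≼ c (b , b∈ , c≤b) with DSet≼ b b∈
  ... | b' , b'∈ , b≤b' = b' , b'∈ , F.≤-trans c≤b b≤b'

  Ideal-mono-⊑ : ∀ {T T'} → T ⊑ᶜ T' → IdealOf T ⊆ IdealOf T'
  Ideal-mono-⊑ {T} {T'} T⊑T' =
    DSet≼⇒Ideal⊆ {T} {T'} (Fᵃ.⊆⇒≼ (Fᵃ.Approx-mono-⊑ (λ a → a) T⊑T'))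

  Ideal-resp-≈ᶜ : ∀ {T T'} → T ≈ᶜ T' → IdealOf T ⊆ IdealOf T'
  Ideal-resp-≈ᶜ T≈T' = Ideal-mono-⊑ (≈⇒⊑ T≈T')

  Ideal-≈ᶜ : ∀ {T T'} → T ≈ᶜ T' → IdealOf T ⊆ IdealOf T' × IdealOf T' ⊆ IdealOf T
  Ideal-≈ᶜ T≈T' = Ideal-resp-≈ᶜ T≈T' , Ideal-resp-≈ᶜ (≈ᶜ-sym T≈T')

  DSet⊆Ideal : ∀ T → F.DSet T ⊆ IdealOf T
  DSet⊆Ideal T b b∈ = b , b∈ , F.≤-refl b

  Ideal-subst : (τ : F.Carrier → CT S F.Carrier) → (∀ b → Fᵃ.UpperBound (F.DSet (τ b)) b) →
                (∀ b → ∃[ a ] (F.DSet (τ b) a × b F.≤ a)) →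
                ∀ T → IdealOf (subst S τ T) ⊆ IdealOf T × IdealOf T ⊆ IdealOf (subst S τ T)
  Ideal-subst τ τ≤ ≤τ T =
    DSet≼⇒Ideal⊆ {subst S τ T} {T} (Fᵃ.Approx-subst≼Approx (λ b → b) τ (λ b → b) τ≤ T) ,
    DSet≼⇒Ideal⊆ {T} {subst S τ T} (Fᵃ.Approx≼Approx-subst (λ b → b) τ (λ b → b) ≤chain T)
    where
    ≤chain : ∀ b → ∃[ d ] (b F.≤ Fᵃ.chain (λ b → b) (τ b) d)
    ≤chain b with ≤τ b
    ... | a , a∈ , b≤a with Fᵃ.Approx-≤-chain (λ b → b) (τ b) a∈
    ... | d , a≤ = d , F.≤-trans b≤a a≤

  opᴵ : (f : Op) → (Fin (ar f) → I) → I
  opᴵ f Cs = nodeCT S f (λ i → proj₁ (Cs i)) , Δ-node f _ (λ i → proj₂ (Cs i))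

  OpSet : (f : Op) → (Fin (ar f) → I) → F.Carrier → Set
  OpSet f Cs = Fᵃ.OpImage f (λ i → IdealOf (proj₁ (Cs i)))

  Ideal-op⊆↓OpSet : ∀ f Cs → IdealOf (proj₁ (opᴵ f Cs)) ⊆ F.↓ (OpSet f Cs)
  Ideal-op⊆↓OpSet f Cs c (b , b∈ , c≤b)
    with Fᵃ.Approx-node≼NodeSet (λ a → a) f (λ i → proj₁ (Cs i)) b b∈
  ... | b' , (bs , bs∈ , b'≡) , b≤b' =
    b' , (bs , (λ i → DSet⊆Ideal (proj₁ (Cs i)) (bs i) (bs∈ i)) , b'≡) , F.≤-trans c≤b b≤b'

  ↓OpSet⊆Ideal-op : ∀ f Cs → F.↓ (OpSet f Cs) ⊆ IdealOf (proj₁ (opᴵ f Cs))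
  ↓OpSet⊆Ideal-op f Cs c (b , (bs , bs∈ , refl) , c≤b)
    with Fᵃ.NodeSet≼Approx-node (λ a → a) f (λ i → proj₁ (Cs i)) (F.op f bs')
           (bs' , (λ i → proj₁ (proj₂ (bs∈ i))) , refl)
    where
    bs' : Fin (ar f) → F.Carrier
    bs' i = proj₁ (bs∈ i)
  ... | b'' , b''∈ , bs'≤b'' =
    b'' , b''∈ , F.≤-trans c≤b (F.≤-trans (F.op-mono f _ _ (λ i → proj₂ (proj₂ (bs∈ i))))
                                          bs'≤b'')

  opᴵ-mono : ∀ f (Cs Ds : Fin (ar f) → I) → (∀ i → Cs i ≤ᴵ Ds i) → opᴵ f Cs ≤ᴵ opᴵ f Ds
  opᴵ-mono f Cs Ds Cs≤Ds c c∈ with Ideal-op⊆↓OpSet f Cs c c∈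
  ... | b , (bs , bs∈ , b≡) , c≤b =
    ↓OpSet⊆Ideal-op f Ds c (b , (bs , (λ i → Cs≤Ds i (bs i) (bs∈ i)) , b≡) , c≤b)

  Cstr : IsOAlg S I _≤ᴵ_
  Cstr = record
    { ≤-refl = λ C c c∈ → c∈
    ; ≤-trans = λ C≤D D≤E c c∈ → D≤E c (C≤D c c∈)
    ; ⊥ = ⊥CT S , Δ-⊥
    ; ⊥-min = λ C → DSet≼⇒Ideal⊆ {⊥CT S} {proj₁ C} λ b b∈ →
                F.⊥ , Fᵃ.⊥∈Approx (λ a → a) (proj₁ C) ,
                proj₁ (Fᵃ.sup-Approx-⊥ (λ a → a)) b b∈
    ; op = opᴵ
    ; op-mono = opᴵ-mono
    }

  CA : OAlg S
  CA = CAlg S QR E X Fω ηω F η Cstr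

  private
    module C = OAlg CA
    module Cᵃ = OrderedAlgebra S CA

  ηᴵ : X → I
  ηᴵ x = leaf S (η x) , Δ-var (η x)

  Ideal-ηᴵ⇔ : ∀ x c → IdealOf (proj₁ (ηᴵ x)) c ⇔ (c F.≤ η x)
  Ideal-ηᴵ⇔ x c =
    (λ { (b , b∈ , c≤b) → F.≤-trans c≤b (proj₁ (Fᵃ.sup-Approx-leaf (λ a → a) (η x)) b b∈) }) ,
    (λ c≤ηx → η x , (var (η x) , (1 , var≪) , refl) , c≤ηx)

  αᴵ : (T : CT S I) → Δ I T → I
  αᴵ T T∈Δ = subst S proj₁ T , Δ-subst proj₁ proj₂ T T∈Δ

  evalᴵ : FT S I → CT S F.Carrier
  evalᴵ s = proj₁ (C.eval (λ D → D) s)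

  evalᴵ≈subst-fin : ∀ s → evalᴵ s ≈ᶜ subst S proj₁ (fin s)
  evalᴵ≈subst-fin ⊥t = ≈ᶜ-sym (subst-fin-⊥ proj₁)
  evalᴵ≈subst-fin (var x) = ≈ᶜ-sym (subst-fin-var proj₁ x)
  evalᴵ≈subst-fin (node f ss) =
    ≈ᶜ-trans (nodeCT-resp f (λ i → evalᴵ≈subst-fin (ss i))) (≈ᶜ-sym (subst-fin-node proj₁ f ss))

  Ideal-α→Ideal-cut : ∀ T c → IdealOf (subst S proj₁ T) c →
                      ∃[ s ] (s ≪ᶜ T × IdealOf (evalᴵ s) c)
  Ideal-α→Ideal-cut T c (b , (u , (n , u≪) , b≡) , c≤b) =
    approx T n , (n , ≪-refl _) ,
    Ideal-resp-≈ᶜ (≈ᶜ-sym (evalᴵ≈subst-fin (approx T n))) c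
      (b , (u , (n , ≪-trans u≪ (subT-mono-≪ proj₁ n (approx-≪-trunc T n))) , b≡) , c≤b)

  Ideal-cut⊆Ideal-α : ∀ T {s} → s ≪ᶜ T → IdealOf (evalᴵ s) ⊆ IdealOf (subst S proj₁ T)
  Ideal-cut⊆Ideal-α T s≪ c c∈ =
    Ideal-mono-⊑ (subst-mono proj₁ (≪ᶜ⇒fin-⊑ {T = T} s≪)) c
                 (Ideal-resp-≈ᶜ (evalᴵ≈subst-fin _) c c∈)

  αᴵ-sup : ∀ T T∈Δ → C.IsSup (C.DSet T) (αᴵ T T∈Δ)
  αᴵ-sup T T∈Δ = ub , least
    where
    ub : Cᵃ.UpperBound (C.DSet T) (αᴵ T T∈Δ)
    ub D (s , s≪ , refl) = Ideal-cut⊆Ideal-α T s≪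
    least : ∀ V → Cᵃ.UpperBound (C.DSet T) V → αᴵ T T∈Δ ≤ᴵ V
    least V ≤V c c∈ with Ideal-α→Ideal-cut T c c∈
    ... | s , s≪ , c∈s = ≤V _ (s , s≪ , refl) c c∈s

  opᴵ-sup : ∀ f (ts : Fin (ar f) → CT S I) (Us : Fin (ar f) → I) → (∀ i → Δ I (ts i)) →
            (∀ i → C.IsSup (C.DSet (ts i)) (Us i)) →
            C.IsSup (Cᵃ.OpImage f (λ i → C.DSet (ts i))) (opᴵ f Us)
  opᴵ-sup f ts Us ts∈Δ Us-sup = ub , least
    where
    ub : Cᵃ.UpperBound (Cᵃ.OpImage f (λ i → C.DSet (ts i))) (opᴵ f Us)
    ub D (Ds , Ds∈ , refl) = opᴵ-mono f Ds Us (λ i → proj₁ (Us-sup i) (Ds i) (Ds∈ i))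
    least : ∀ V → Cᵃ.UpperBound (Cᵃ.OpImage f (λ i → C.DSet (ts i))) V → opᴵ f Us ≤ᴵ V
    least V ≤V c c∈ with Ideal-op⊆↓OpSet f Us c c∈
    ... | b , (cs , cs∈ , b≡) , c≤b =
      ≤V (opᴵ f Ds) (Ds , (λ i → proj₁ (cut i) , proj₁ (proj₂ (cut i)) , refl) , refl) c
        (↓OpSet⊆Ideal-op f Ds c (b , (cs , (λ i → proj₂ (proj₂ (cut i))) , b≡) , c≤b))
      where
      Us≤α : ∀ i → Us i ≤ᴵ αᴵ (ts i) (ts∈Δ i)
      Us≤α i = proj₂ (Us-sup i) (αᴵ (ts i) (ts∈Δ i)) (proj₁ (αᴵ-sup (ts i) (ts∈Δ i)))
      cut : ∀ i → ∃[ s ] (s ≪ᶜ ts i × IdealOf (evalᴵ s) (cs i))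
      cut i = Ideal-α→Ideal-cut (ts i) (cs i) (Us≤α i (cs i) (cs∈ i))
      Ds : Fin (ar f) → I
      Ds i = C.eval (λ D → D) (proj₁ (cut i))

  CΔ : IsDeltaAlg S QR CA
  CΔ = record { α = αᴵ ; α-sup = αᴵ-sup ; op-sup = opᴵ-sup }

module Isomorphism (S : Sig) (QR : QuasiRegular S) (E : FT S ℕ → FT S ℕ → Set) (X : Set)
  (Fω : OAlg S) (ηω : X → Car S Fω) (FO : FreeOmega S E X Fω ηω)
  (F : OAlg S) (η : X → Car S F) (FV : FreeV S E X F η) where

  open Sig S
  open QuasiRegular QR
  open Coterms S
  open QuasiRegularProperties S QR
  open FreeDeltaAlgebra S QR E X Fω ηω FO F η
  open IdealCompletion S QR E X Fω ηω F η
  open FreeOmegaComparison S E X Fω ηω FO F (FreeV.F-sat FV) η using (≤⇒Approx≼)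
  private
    module F = OAlg F
    module Fᵃ = Approximations S F
    module Fω = OAlg Fω
    module Fωᵃ = Approximations S Fω
    module Fωᶜ = Fωᵃ.Continuous (FreeOmega.F-cont FO)
    module R = OAlg RA
    module C = OAlg CA

  φ : R → I
  φ r = mapCT S η (term r) , Δ-mapCT η (term r) (term∈Δ r)

  φ-mono : ∀ {r r'} → r R.≤ r' → φ r C.≤ φ r'
  φ-mono {r} {r'} r≤r' =
    DSet≼⇒Ideal⊆ {proj₁ (φ r)} {proj₁ (φ r')}
      (Fᵃ.≼-trans {F.DSet (proj₁ (φ r))} (Fᵃ.Approx-map≼Approx (λ b → b) η (term r))
        (Fᵃ.≼-trans {F.Approx η (term r)}
          (≤⇒Approx≼ (term r) (term r') (value-sup r) (value-sup r') r≤r')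
          (Fᵃ.Approx≼Approx-map (λ b → b) η (term r'))))

  φ-α : ∀ T T∈Δ φT∈Δ → φ (αᴿ T T∈Δ) C.≈ αᴵ (mapCT S φ T) φT∈Δ
  φ-α T T∈Δ φT∈Δ = Ideal-≈ᶜ terms≈
    where
    terms≈ : mapCT S η (subst S term T) ≈ᶜ subst S proj₁ (mapCT S φ T)
    terms≈ = ≈ᶜ-trans (subst-subst term (λ x → leaf S (η x)) T)
               (≈ᶜ-sym (≈ᶜ-trans (subst-subst (λ r → leaf S (φ r)) proj₁ T)
                                  (subst-resp-σ (λ r → subst-leaf proj₁ (φ r)) T)))

  φ-mor : IsDeltaMor S QR RA RΔ CA CΔ φ
  φ-mor = record
    { strict = Ideal-≈ᶜ (subst-⊥ (λ x → leaf S (η x)))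
    ; mono = λ {r} {r'} → φ-mono {r} {r'}
    ; pres-α = φ-α
    }

  φ-ηᴿ : ∀ x → φ (ηᴿ x) C.≈ ηᴵ x
  φ-ηᴿ x = Ideal-≈ᶜ (subst-leaf (λ y → leaf S (η y)) x)

  endo-unique : ∀ e → IsMor S F F e → (∀ x → e (η x) F.≈ η x) → ∀ b → e b F.≈ b
  endo-unique e e-mor e-η b =
    Fᵃ.≈-trans (unique e e-mor e-η b) (Fᵃ.≈-sym (unique (λ b → b) id-mor (λ x → Fᵃ.≈-refl _) b))
    where
    unique = proj₂ (proj₂ (proj₂ (FreeV.univ FV F (FreeV.F-sat FV) η)))
    id-mor : IsMor S F F (λ b → b)
    id-mor = record { strict = Fᵃ.≈-refl _ ; mono = λ b≤b' → b≤b' ; hom = λ f bs → Fᵃ.≈-refl _ }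

  private
    comparison = FreeV.univ FV Fω (FreeOmega.F-sat FO) ηω
    module k = IsMor (proj₁ (proj₂ comparison))

  k : F.Carrier → Fω.Carrier
  k = proj₁ comparison

  k-η : ∀ x → k (η x) Fω.≈ ηω x
  k-η = proj₁ (proj₂ (proj₂ comparison))

  k-eval : ∀ {V} (env : V → F.Carrier) s → k (F.eval env s) Fω.≈ Fω.eval (λ v → k (env v)) s
  k-eval = Fωᵃ.eval-hom F k k.strict k.hom

  _≤ᵀ_ : FT S X → FT S X → Set
  s ≤ᵀ s' = F.eval η s F.≤ F.eval η s'

  TermAlg : OAlg S
  TermAlg = mkOAlg (FT S X) _≤ᵀ_ (record
    { ≤-refl = λ s → F.≤-refl _
    ; ≤-trans = F.≤-trans
    ; ⊥ = ⊥t
    ; ⊥-min = λ s → F.⊥-min _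
    ; op = node
    ; op-mono = λ f ss ss' → F.op-mono f _ _
    })

  TermAlg-sat : Sat S E TermAlg
  TermAlg-sat =
    Fᵃ.sat-reflect TermAlg (F.eval η) (Fᵃ.≈-refl _) (λ f ss → Fᵃ.≈-refl _) E (λ s≤s' → s≤s')
                   (FreeV.F-sat FV)

  private
    representation = FreeV.univ FV TermAlg TermAlg-sat var
    module rep = IsMor (proj₁ (proj₂ representation))

  represent : F.Carrier → FT S X
  represent = proj₁ representation

  eval-represent : ∀ b → F.eval η (represent b) F.≈ b
  eval-represent = endo-unique (λ b → F.eval η (represent b))
                     (record { strict = rep.strict ; mono = rep.mono ; hom = rep.hom })
                     (proj₁ (proj₂ (proj₂ representation)))

  representᶜ : F.Carrier → CT S X
  representᶜ b = fin (represent b)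

  ψ : I → R
  ψ (T , T∈Δ) =
    fromTerm (subst S representᶜ T) (Δ-subst representᶜ (λ b → Δ-fin (represent b)) T T∈Δ)

  eval-represent≈k : ∀ b → Fω.eval ηω (represent b) Fω.≈ k b
  eval-represent≈k b =
    Fωᵃ.≈-trans (Fωᵃ.eval-resp-env (λ x → Fωᵃ.≈-sym (k-η x)) (represent b))
      (Fωᵃ.≈-trans (Fωᵃ.≈-sym (k-eval η (represent b)))
                   (k.mono (proj₁ (eval-represent b)) , k.mono (proj₂ (eval-represent b))))

  private
    module Substᵏ =
      Fωᵃ.SubstitutionLemma ηω (λ _ → ⊤) (Fωᶜ.op-sup-Approx ηω) representᶜ (λ _ → tt)
        (λ b → Fω.eval ηω (represent b)) (λ b → Fωᵃ.sup-Approx-fin ηω (represent b))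

  value-ψ-sup : ∀ D → Fω.IsSup (Fω.Approx k (proj₁ D)) (value (ψ D))
  value-ψ-sup D =
    Fωᵃ.sup-resp-env eval-represent≈k (proj₁ D) (Substᵏ.sup-subst⇒sup (proj₁ D) (value-sup (ψ D)))

  ψ-mono : ∀ {D D'} → D C.≤ D' → ψ D R.≤ ψ D'
  ψ-mono {D} {D'} D≤D' =
    Fωᵃ.≼⇒sup-≤ {Fω.Approx k (proj₁ D)} {Fω.Approx k (proj₁ D')}
                Approx≼ (value-ψ-sup D) (value-ψ-sup D')
    where
    Approx≼ : Fω.Approx k (proj₁ D) Fωᵃ.≼ Fω.Approx k (proj₁ D')
    Approx≼ a (s , s≪ , refl) with D≤D' (F.α₀ s) (DSet⊆Ideal (proj₁ D) _ (s , s≪ , refl))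
    ... | b , (s' , s'≪ , refl) , s≤s' =
      Fω.eval k s' , (s' , s'≪ , refl) ,
      Fω.≤-trans (proj₂ (k-eval (λ b → b) s))
                 (Fω.≤-trans (k.mono s≤s') (proj₁ (k-eval (λ b → b) s')))

  ψ-α : ∀ T T∈Δ ψT∈Δ → ψ (αᴵ T T∈Δ) R.≈ αᴿ (mapCT S ψ T) ψT∈Δ
  ψ-α T T∈Δ ψT∈Δ =
    Fωᵃ.sup-unique (value-sup (ψ (αᴵ T T∈Δ)))
                   (Fωᵃ.sup-resp-≈ᶜ ηω terms≈ (value-sup (αᴿ (mapCT S ψ T) ψT∈Δ)))
    where
    terms≈ : subst S term (mapCT S ψ T) ≈ᶜ subst S representᶜ (subst S proj₁ T)
    terms≈ = ≈ᶜ-trans (subst-subst (λ D → leaf S (ψ D)) term T)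
               (≈ᶜ-trans (subst-resp-σ (λ D → subst-leaf term (ψ D)) T)
                         (≈ᶜ-sym (subst-subst proj₁ representᶜ T)))

  ψ-mor : IsDeltaMor S QR CA CΔ RA RΔ ψ
  ψ-mor = record
    { strict = Fωᵃ.sup-unique (value-ψ-sup C.⊥) (Fωᵃ.sup-Approx-⊥ k)
    ; mono = λ {D} {D'} → ψ-mono {D} {D'}
    ; pres-α = ψ-α
    }

  ψφ : ∀ r → ψ (φ r) R.≈ r
  ψφ r =
    Fωᵃ.sup-unique (Fωᵃ.sup-resp-env k-η (term r) (Fωᵃ.sup-Approx-map k η (term r) (value-ψ-sup (φ r))))
                   (value-sup r)

  φψ : ∀ D → φ (ψ D) C.≈ D
  φψ (T , T∈Δ) =
    (λ c c∈ → proj₁ (Ideal-subst τ τ≤ ≤τ T) c (proj₁ (Ideal-≈ᶜ terms≈) c c∈)) ,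
    (λ c c∈ → proj₂ (Ideal-≈ᶜ terms≈) c (proj₂ (Ideal-subst τ τ≤ ≤τ T) c c∈))
    where
    τ : F.Carrier → CT S F.Carrier
    τ b = mapCT S η (representᶜ b)
    terms≈ : mapCT S η (subst S representᶜ T) ≈ᶜ subst S τ T
    terms≈ = subst-subst representᶜ (λ x → leaf S (η x)) T
    τ≤ : ∀ b → Fᵃ.UpperBound (F.DSet (τ b)) b
    τ≤ b = Fᵃ.≼-upperBound (Fᵃ.Approx-map≼Approx (λ b → b) η (representᶜ b)) λ a a∈ →
             F.≤-trans (proj₁ (Fᵃ.sup-Approx-fin η (represent b)) a a∈) (proj₁ (eval-represent b))
    ≤τ : ∀ b → ∃[ a ] (F.DSet (τ b) a × b F.≤ a)
    ≤τ b with Fᵃ.Approx≼Approx-map (λ b → b) η (representᶜ b) _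
                (represent b , ≪-fin (represent b) , refl)
    ... | a , a∈ , ≤a = a , a∈ , F.≤-trans (proj₂ (eval-represent b)) ≤a

theorem4p1 : (S : Sig) (QR : QuasiRegular S) (E : FT S ℕ → FT S ℕ → Set) (X : Set)
             (Fω : OAlg S) (ηω : X → Car S Fω) → FreeOmega S E X Fω ηω →
             (F : OAlg S) (η : X → Car S F) → FreeV S E X F η →
             Conclusion S QR E X Fω ηω F η
theorem4p1 S QR E X Fω ηω FO F η FV = record
  { Rstr = Rstr
  ; R-⊥ = refl
  ; R-op = λ f rs → refl
  ; ηR = ηᴿ
  ; ηR-def = λ x → refl
  ; RΔ = RΔ
  ; R-sat = R-sat
  ; R-free = λ A dA satA h → let open Universal A dA satA h in g , g-mor , g-ηᴿ , g-unique
  ; Cstr = Cstr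
  ; C-op = λ f Cs c → Ideal-op⊆↓OpSet f Cs c , ↓OpSet⊆Ideal-op f Cs c
  ; ηC = ηᴵ
  ; ηC-def = Ideal-ηᴵ⇔
  ; CΔ = CΔ
  ; φ = φ
  ; ψ = ψ
  ; φ-mor = φ-mor
  ; ψ-mor = ψ-mor
  ; ψφ = ψφ
  ; φψ = φψ
  ; φ-gen = φ-ηᴿ
  }
  where
  open FreeDeltaAlgebra S QR E X Fω ηω FO F η
  open IdealCompletion S QR E X Fω ηω F η
  open Isomorphism S QR E X Fω ηω FO F η FV
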